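{- Let $a,b,c$ be positive reals (or indeterminates) and for $n\geq1$ let $\Sigma_n$ be the loopless Schreier graph of the Hanoi Towers group $H^{(3)}$ on level $n$ and $T_n,U_n,R_n,L_n,Q_n$ its weighted generating functions, as defined in the context. Then for every $n\geq1$: $$T_{n+1}=T_n^3(ab+ac+bc)+2abcT_n^2(U_n+R_n+L_n),$$ $$U_{n+1}=bT_n^3+T_n^2\big((ab+ac+bc)U_n+2b(aR_n+cL_n)\big)+abcT_n\big(3R_nL_n+U_n(L_n+R_n+2U_n)\big)+abcT_n^2Q_n,$$ $$R_{n+1}=aT_n^3+T_n^2\big((ab+ac+bc)R_n+2a(bU_n+cL_n)\big)+abcT_n\big(3U_nL_n+R_n(L_n+U_n+2R_n)\big)+abcT_n^2Q_n,$$ $$L_{n+1}=cT_n^3+T_n^2\big((ab+ac+bc)L_n+2c(aR_n+bU_n)\big)+abcT_n\big(3R_nU_n+L_n(U_n+R_n+2L_n)\big)+abcT_n^2Q_n,$$ $$\begin{aligned}Q_{n+1}={}&4abcT_nQ_n(U_n+R_n+L_n)+T_n^2\big((2b+a+c)U_n+(2a+b+c)R_n+(2c+a+b)L_n\big)+T_n^2Q_n(ab+ac+bc)+T_n^3\\&+2abc\big(U_n^2(R_n+L_n)+R_n^2(U_n+L_n)+L_n^2(U_n+R_n)+U_nR_nL_n\big)\\&+2T_n\big(U_nR_n(ac+bc+2ab)+U_nL_n(ab+ac+2bc)+R_nL_n(ab+bc+2ac)+bU_n^2(a+c)+aR_n^2(b+c)+cL_n^2(a+b)\big),\end{aligned}$$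 with $T_1=ab+ac+bc$, $U_1=b$, $R_1=a$, $L_1=c$, $Q_1=1$.
   Context: Let $X=\{0,1,2\}$ and let $H^{(3)}$ be the group of automorphisms of the rooted ternary tree (whose level-$n$ vertices are the words of length $n$ over $X$) generated by $a,b,c$ defined recursively by $a(0w)=1w$, $a(1w)=0w$, $a(2w)=2a(w)$; $b(0w)=2w$, $b(2w)=0w$, $b(1w)=1b(w)$; $c(1w)=2w$, $c(2w)=1w$, $c(0w)=0c(w)$ (i.e. $a=(01)(id,id,a)$, $b=(02)(id,b,id)$, $c=(12)(c,id,id)$). The graph $\Sigma_n$ has vertex set $X^n$ and, for each $s\in\{a,b,c\}$ and each word $u$ with $s(u)\neq u$, an edge $\{u,s(u)\}$ labelled $s$ (the loops at $0^n,1^n,2^n$ are removed). Its outmost vertices are $0^n$ (called leftmost), $1^n$ (called top) and $2^n$ (called rightmost). Weights: an edge labelled $w$ has weight $w$; a spanning subgraph has weight the product of the weights of its edges. $T_n$ = sum of weights of spanning trees of $\Sigma_n$. $U_n$ = sum of weights of two-component spanning forests in which $0^n$ and $2^n$ lie in one component and $1^n$ in the other; $R_n$ = same with $2^n$ alone in its component (and $0^n,1^n$ together); $L_n$ = same with $0^n$ alone in its component (and $1^n,2^n$ together). $Q_n$ = sum of weights of three-component spanning forests in which $0^n,1^n,2^n$ lie in three different components. -}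

module Defs where

open import Level using (Level)
open import Data.Nat using (ℕ; zero; suc; _^_; _<ᵇ_)
open import Data.Fin using (Fin; zero; suc; toℕ)
import Data.Fin as Fin
open import Data.Vec using (Vec; []; _∷_)
import Data.Vec.Properties as VecP
open import Data.List using (List; []; _∷_; _++_; map; foldr; concatMap)
open import Data.Bool.ListAction using (all; any)
open import Data.Bool using (Bool; true; false; _∧_; _∨_; not; if_then_else_)
open import Data.Product using (_×_; _,_)
open import Relation.Nullary using (does)
open import Algebra.Bundles using (CommutativeSemiring)

X : Set
X = Fin 3

x0 x1 x2 : X
x0 = zero
x1 = suc zero
x2 = suc (suc zero)

Word : ℕ → Set
Word n = Vec X n

data Gen : Set where
  ga gb gc : Gen

-- a = (01)(id,id,a),  b = (02)(id,b,id),  c = (12)(c,id,id)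
-- (the first letter of the word is the top-level letter)
act : Gen → ∀ {n} → Word n → Word n
act s [] = []
act ga (zero ∷ w) = x1 ∷ w
act ga (suc zero ∷ w) = x0 ∷ w
act ga (suc (suc zero) ∷ w) = x2 ∷ act ga w
act gb (zero ∷ w) = x2 ∷ w
act gb (suc (suc zero) ∷ w) = x0 ∷ w
act gb (suc zero ∷ w) = x1 ∷ act gb w
act gc (suc zero ∷ w) = x2 ∷ w
act gc (suc (suc zero) ∷ w) = x1 ∷ w
act gc (zero ∷ w) = x0 ∷ act gc w

words : (n : ℕ) → List (Word n)
words zero = [] ∷ []
words (suc n) = concatMap (λ x → map (x ∷_) (words n)) (x0 ∷ x1 ∷ x2 ∷ [])

const : (n : ℕ) → X → Word n
const zero x = []
const (suc n) x = x ∷ const n x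

eqW : ∀ {n} → Word n → Word n → Bool
eqW u v = does (VecP.≡-dec Fin._≟_ u v)

-- strict lexicographic order, used only to list each edge once
lexLess : ∀ {n} → Word n → Word n → Bool
lexLess [] [] = false
lexLess (x ∷ u) (y ∷ v) = (toℕ x <ᵇ toℕ y) ∨ (does (x Fin.≟ y) ∧ lexLess u v)

-- The graph Σ_n: an edge labelled s is {u, s(u)} with s(u) ≠ u,
-- represented once as (s , u) with u < s(u) lexicographically.

Edge : ℕ → Set
Edge n = Gen × Word n

end₁ end₂ : ∀ {n} → Edge n → Word n
end₁ (s , u) = u
end₂ (s , u) = act s u

edges : (n : ℕ) → List (Edge n)
edges n = concatMap (λ s → concatMap (λ u → if lexLess u (act s u) then (s , u) ∷ [] else []) (words n))
                    (ga ∷ gb ∷ gc ∷ [])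

-- all spanning subgraphs = all sublists of the edge list
sublists : ∀ {A : Set} → List A → List (List A)
sublists [] = [] ∷ []
sublists (x ∷ xs) = map (x ∷_) (sublists xs) ++ sublists xs

removals : ∀ {A : Set} → List A → List (A × List A)
removals [] = []
removals (x ∷ xs) = (x , xs) ∷ map (λ { (y , ys) → (y , x ∷ ys) }) (removals xs)

iterate : ∀ {A : Set} → ℕ → (A → A) → A → A
iterate zero f x = x
iterate (suc k) f x = f (iterate k f x)

step : ∀ {n} → List (Edge n) → (Word n → Bool) → (Word n → Bool)
step F S v = S v ∨ any (λ e → (S (end₁ e) ∧ eqW v (end₂ e)) ∨ (S (end₂ e) ∧ eqW v (end₁ e))) F

-- conn F u v : u and v are joined by a path in F (paths have length < 3^n = |X^n|)
conn : ∀ {n} → List (Edge n) → Word n → Word n → Bool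
conn {n} F u v = iterate (3 ^ n) (step F) (eqW u) v

-- F has no cycle: no edge of F has its endpoints joined in F minus that edge
acyclic : ∀ {n} → List (Edge n) → Bool
acyclic F = all (λ { (e , F′) → not (conn F′ (end₁ e) (end₂ e)) }) (removals F)

isTree : ∀ {n} → List (Edge n) → Bool
isTree {n} F = acyclic F ∧ all (conn F (const n x0)) (words n)

isForest2 : ∀ {n} → Word n → Word n → Word n → List (Edge n) → Bool
isForest2 {n} p q r F =
  acyclic F ∧ conn F p q ∧ not (conn F p r)
  ∧ all (λ v → conn F p v ∨ conn F r v) (words n)

isForest3 : ∀ {n} → List (Edge n) → Bool
isForest3 {n} F =
  acyclic F ∧ not (conn F o0 o1) ∧ not (conn F o0 o2) ∧ not (conn F o1 o2)
  ∧ all (λ v → conn F o0 v ∨ conn F o1 v ∨ conn F o2 v) (words n)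
  where o0 = const n x0
        o1 = const n x1
        o2 = const n x2

-- Weighted generating functions, with weights a, b, c in any commutative
-- semiring (this covers positive reals and polynomial indeterminates).

module GF {r ℓ} (Rg : CommutativeSemiring r ℓ) (a b c : CommutativeSemiring.Carrier Rg) where
  open CommutativeSemiring Rg

  wGen : Gen → Carrier
  wGen ga = a
  wGen gb = b
  wGen gc = c

  weight : ∀ {n} → List (Edge n) → Carrier
  weight F = foldr (λ { (s , u) acc → wGen s * acc }) 1# F

  gsum : (n : ℕ) → (List (Edge n) → Bool) → Carrier
  gsum n P = foldr (λ F acc → (if P F then weight F else 0#) + acc) 0# (sublists (edges n))

  T U R L Q : ℕ → Carrier
  T n = gsum n isTree
  U n = gsum n (isForest2 (const n x0) (const n x2) (const n x1))
  R n = gsum n (isForest2 (const n x0) (const n x1) (const n x2))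
  L n = gsum n (isForest2 (const n x1) (const n x2) (const n x0))
  Q n = gsum n isForest3

  two three four : Carrier
  two = 1# + 1#
  three = two + 1#
  four = two + two

-- The words of length n+1 ending in x span a copy of Σ_n, and Σ_{n+1} is these three copies joined by
-- three bridges, {2ⁿ0, 2ⁿ1}, {1ⁿ0, 1ⁿ2} and {0ⁿ1, 0ⁿ2}, each linking outmost vertices of two copies.  So a
-- spanning subgraph of Σ_{n+1} is a spanning subgraph of each copy together with a set of bridges.  It is a
-- forest all of whose components contain an outmost vertex exactly when each copy's subgraph is such a
-- forest and the graph on the nine corners of the copies (corners identified within a copy according to how
-- that forest partitions them, plus the chosen bridges) is acyclic with every corner joined to one of
-- 0ⁿ⁺¹, 1ⁿ⁺¹, 2ⁿ⁺¹; and the partition of the outmost vertices it induces is read off that graph too.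
-- Hence the generating function of each partition type at level n+1 is a finite sum over the types of the
-- three pieces and the 2³ bridge sets, i.e. a polynomial in a, b, c, T_n, U_n, R_n, L_n, Q_n, which the
-- ring solver identifies with the stated right-hand side.  The values at n = 1 are computed outright.

module Submission where

open import Algebra.Bundles using (CommutativeSemiring)
open import Data.Nat using (ℕ; zero; suc; _≤_)
open import Data.Product using (_×_; _,_)
open import Defs

module ListLemmas where

  open import Data.Bool using (Bool; true; false; _∧_; _∨_; not)
  open import Data.Bool.ListAction using (all; any)
  open import Data.List using (List; []; _∷_; _++_; map; concatMap)
  open import Data.List.Membership.Propositional using (_∈_; find)
  open import Data.List.Membership.Propositional.Properties
    using (∈-map⁺; ∈-map⁻; ∈-concatMap⁻)
  open import Data.List.Membership.Propositional.Properties.WithK using (unique∧set⇒bag)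
  open import Data.List.Relation.Unary.Any using (here; there)
  open import Data.List.Relation.Unary.All using (lookup)
  open import Data.List.Relation.Unary.AllPairs using ([]; _∷_)
  open import Data.List.Relation.Unary.Unique.Propositional using (Unique)
  import Data.List.Relation.Unary.Unique.Propositional.Properties as Unique
  open import Data.List.Relation.Binary.BagAndSetEquality using (∼bag⇒↭)
  open import Data.List.Relation.Binary.Permutation.Propositional using (_↭_; ↭-refl; ↭-trans; prep; swap)
  open import Data.Product using (_×_; _,_; Σ; proj₁; proj₂)
  open import Function using (_∘_)
  open import Data.Empty using (⊥)
  open import Data.Sum using (_⊎_; inj₁; inj₂)
  open import Function.Bundles using (mk⇔)
  open import Relation.Binary.PropositionalEquality

  open import Defs using (removals)

  ∨-true⁻ : ∀ {x y} → x ∨ y ≡ true → x ≡ true ⊎ y ≡ true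
  ∨-true⁻ {true} _ = inj₁ refl
  ∨-true⁻ {false} p = inj₂ p

  ∨-trueˡ : ∀ {x} y → x ≡ true → x ∨ y ≡ true
  ∨-trueˡ y refl = refl

  ∨-trueʳ : ∀ x {y} → y ≡ true → x ∨ y ≡ true
  ∨-trueʳ true _ = refl
  ∨-trueʳ false p = p

  ∧-true⁻ : ∀ {x y} → x ∧ y ≡ true → x ≡ true × y ≡ true
  ∧-true⁻ {true} {true} _ = refl , refl

  ∧-true⁺ : ∀ {x y} → x ≡ true → y ≡ true → x ∧ y ≡ true
  ∧-true⁺ refl refl = refl

  not-true⁻ : ∀ {x} → not x ≡ true → x ≡ false
  not-true⁻ {false} _ = refl

  not-true⁺ : ∀ {x} → x ≡ false → not x ≡ true
  not-true⁺ refl = refl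

  true≢false : true ≢ false
  true≢false ()

  module _ {A : Set} (p : A → Bool) where

    any-true⁻ : ∀ xs → any p xs ≡ true → Σ A λ x → x ∈ xs × p x ≡ true
    any-true⁻ (x ∷ xs) e with p x in px
    ... | true = x , here refl , px
    ... | false with any-true⁻ xs e
    ... | y , y∈ , py = y , there y∈ , py

    any-true⁺ : ∀ {x xs} → x ∈ xs → p x ≡ true → any p xs ≡ true
    any-true⁺ (here refl) px rewrite px = refl
    any-true⁺ {xs = y ∷ _} (there x∈) px = ∨-trueʳ (p y) (any-true⁺ x∈ px)

    all-true⁻ : ∀ {x xs} → all p xs ≡ true → x ∈ xs → p x ≡ true
    all-true⁻ e (here refl) = proj₁ (∧-true⁻ e)
    all-true⁻ {xs = y ∷ _} e (there x∈) = all-true⁻ (proj₂ (∧-true⁻ {p y} e)) x∈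

    all-true⁺ : ∀ xs → (∀ {x} → x ∈ xs → p x ≡ true) → all p xs ≡ true
    all-true⁺ [] _ = refl
    all-true⁺ (x ∷ xs) h = ∧-true⁺ (h (here refl)) (all-true⁺ xs (h ∘ there))

    all-false⁻ : ∀ xs → all p xs ≡ false → Σ A λ x → x ∈ xs × p x ≡ false
    all-false⁻ (x ∷ xs) e with p x in px
    ... | false = x , here refl , px
    ... | true with all-false⁻ xs e
    ... | y , y∈ , py = y , there y∈ , py

  module _ {A : Set} where

    removals-∷⁻ : ∀ {x : A} {xs e L} → (e , L) ∈ removals (x ∷ xs) →
      (e ≡ x × L ≡ xs) ⊎ (Σ (List A) λ L′ → (e , L′) ∈ removals xs × L ≡ x ∷ L′)
    removals-∷⁻ (here refl) = inj₁ (refl , refl)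
    removals-∷⁻ {xs = xs} (there m) with ∈-map⁻ _ {xs = removals xs} m
    ... | (_ , L′) , m′ , refl = inj₂ (L′ , m′ , refl)

    removals-∷⁺ : ∀ {x : A} {xs e L} → (e , L) ∈ removals xs → (e , x ∷ L) ∈ removals (x ∷ xs)
    removals-∷⁺ {x} m = there (∈-map⁺ (λ { (y , ys) → (y , x ∷ ys) }) m)

    removals-++⁻ : ∀ (xs ys : List A) {e L} → (e , L) ∈ removals (xs ++ ys) →
      (Σ (List A) λ L₁ → (e , L₁) ∈ removals xs × L ≡ L₁ ++ ys)
      ⊎ (Σ (List A) λ L₂ → (e , L₂) ∈ removals ys × L ≡ xs ++ L₂)
    removals-++⁻ [] ys m = inj₂ (_ , m , refl)
    removals-++⁻ (x ∷ xs) ys m with removals-∷⁻ m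
    ... | inj₁ (refl , refl) = inj₁ (xs , here refl , refl)
    ... | inj₂ (L′ , m′ , refl) with removals-++⁻ xs ys m′
    ... | inj₁ (L₁ , m₁ , refl) = inj₁ (x ∷ L₁ , removals-∷⁺ m₁ , refl)
    ... | inj₂ (L₂ , m₂ , refl) = inj₂ (L₂ , m₂ , refl)

    removals-++ˡ : ∀ {xs : List A} ys {e L} → (e , L) ∈ removals xs → (e , L ++ ys) ∈ removals (xs ++ ys)
    removals-++ˡ {x ∷ xs} ys m with removals-∷⁻ m
    ... | inj₁ (refl , refl) = here refl
    ... | inj₂ (L′ , m′ , refl) = removals-∷⁺ (removals-++ˡ ys m′)

    removals-++ʳ : ∀ (xs : List A) {ys e L} → (e , L) ∈ removals ys → (e , xs ++ L) ∈ removals (xs ++ ys)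
    removals-++ʳ [] m = m
    removals-++ʳ (x ∷ xs) m = removals-∷⁺ (removals-++ʳ xs m)

    removals-∈ : ∀ {xs : List A} {e L} → (e , L) ∈ removals xs → e ∈ xs
    removals-∈ {x ∷ xs} m with removals-∷⁻ m
    ... | inj₁ (refl , refl) = here refl
    ... | inj₂ (_ , m′ , refl) = there (removals-∈ m′)

    removals-⊆ : ∀ {xs : List A} {e L z} → (e , L) ∈ removals xs → z ∈ L → z ∈ xs
    removals-⊆ {x ∷ xs} m z∈ with removals-∷⁻ m | z∈
    ... | inj₁ (refl , refl) | _ = there z∈
    ... | inj₂ (_ , m′ , refl) | here refl = here refl
    ... | inj₂ (_ , m′ , refl) | there z∈′ = there (removals-⊆ m′ z∈′)

    removals-split : ∀ {xs : List A} {e L z} → (e , L) ∈ removals xs → z ∈ xs → z ≡ e ⊎ z ∈ L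
    removals-split {x ∷ xs} m z∈ with removals-∷⁻ m | z∈
    ... | inj₁ (refl , refl) | here refl = inj₁ refl
    ... | inj₁ (refl , refl) | there z∈′ = inj₂ z∈′
    ... | inj₂ (_ , m′ , refl) | here refl = inj₂ (here refl)
    ... | inj₂ (_ , m′ , refl) | there z∈′ with removals-split m′ z∈′
    ... | inj₁ eq = inj₁ eq
    ... | inj₂ z∈″ = inj₂ (there z∈″)

    ∈⇒removals : ∀ {xs : List A} {e} → e ∈ xs → Σ (List A) λ L → (e , L) ∈ removals xs
    ∈⇒removals {x ∷ xs} (here refl) = xs , here refl
    ∈⇒removals {x ∷ xs} (there e∈) with ∈⇒removals e∈
    ... | L , m = x ∷ L , removals-∷⁺ m

    removals-↭ : ∀ {xs : List A} {e L} → (e , L) ∈ removals xs → xs ↭ e ∷ L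
    removals-↭ {x ∷ xs} m with removals-∷⁻ m
    ... | inj₁ (refl , refl) = ↭-refl
    ... | inj₂ (_ , m′ , refl) = ↭-trans (prep x (removals-↭ m′)) (swap x _ ↭-refl)

  module _ {A B : Set} (f : A → B) where

    removals-map⁻ : ∀ (xs : List A) {e L} → (e , L) ∈ removals (map f xs) →
      Σ A λ e₀ → Σ (List A) λ L₀ → (e₀ , L₀) ∈ removals xs × e ≡ f e₀ × L ≡ map f L₀
    removals-map⁻ (x ∷ xs) m with removals-∷⁻ m
    ... | inj₁ (refl , refl) = x , xs , here refl , refl , refl
    ... | inj₂ (_ , m′ , refl) with removals-map⁻ xs m′
    ... | e₀ , L₀ , m₀ , refl , refl = e₀ , x ∷ L₀ , removals-∷⁺ m₀ , refl , refl

    removals-map⁺ : ∀ {xs : List A} {e₀ L₀} → (e₀ , L₀) ∈ removals xs → (f e₀ , map f L₀) ∈ removals (map f xs)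
    removals-map⁺ {x ∷ xs} m with removals-∷⁻ m
    ... | inj₁ (refl , refl) = here refl
    ... | inj₂ (_ , m′ , refl) = removals-∷⁺ (removals-map⁺ m′)

  unique-⊆-⊇⇒↭ : ∀ {A : Set} {xs ys : List A} → Unique xs → Unique ys →
    (∀ {z} → z ∈ xs → z ∈ ys) → (∀ {z} → z ∈ ys → z ∈ xs) → xs ↭ ys
  unique-⊆-⊇⇒↭ ux uy ⊆ ⊇ = ∼bag⇒↭ (unique∧set⇒bag ux uy (mk⇔ ⊆ ⊇))

  -- The tag of an element of f x recovers x, so the blocks of the concatenation are disjoint.
  unique-concatMap : ∀ {A B : Set} (f : A → List B) (tag : B → A) {xs} → Unique xs →
    (∀ x → Unique (f x)) → (∀ {x b} → b ∈ f x → tag b ≡ x) → Unique (concatMap f xs)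
  unique-concatMap f tag [] _ _ = []
  unique-concatMap f tag {x ∷ xs} (x∉ ∷ uxs) uf tagged =
    Unique.++⁺ (uf x) (unique-concatMap f tag uxs uf tagged) disjoint
    where
    disjoint : ∀ {z} → z ∈ f x × z ∈ concatMap f xs → ⊥
    disjoint (z∈fx , z∈rest) with find (∈-concatMap⁻ f {xs = xs} z∈rest)
    ... | y , y∈xs , z∈fy = lookup x∉ y∈xs (trans (sym (tagged z∈fx)) (tagged z∈fy))

module Words where

  open import Data.Bool using (true; false; _∨_)
  open import Data.Empty using (⊥-elim)
  open import Function using (_∘_)
  open import Data.Fin using (Fin; zero; suc; toℕ)
  import Data.Fin as Fin
  open import Data.List using (List; []; _∷_; map; length)
  open import Data.List.Properties using (length-++; length-map)
  open import Data.List.Membership.Propositional using (_∈_)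
  open import Data.List.Membership.Propositional.Properties
    using (∈-map⁺; ∈-map⁻; ∈-concatMap⁺)
  open import Data.List.Relation.Unary.Any using (here; there)
  import Data.List.Relation.Unary.Any as Any
  open import Data.List.Relation.Unary.All using ([]; _∷_)
  open import Data.List.Relation.Unary.AllPairs using ([]; _∷_)
  open import Data.List.Relation.Unary.Unique.Propositional using (Unique)
  import Data.List.Relation.Unary.Unique.Propositional.Properties as Unique
  open import Data.Nat using (zero; suc; _+_; _^_; _<ᵇ_)
  open import Data.Product using (_,_; proj₂)
  open import Data.Vec using (Vec; []; _∷_; _∷ʳ_; head)
  import Data.Vec.Properties as Vec
  open import Relation.Nullary using (yes; no)
  open import Relation.Binary.PropositionalEquality

  open import Defs
  open ListLemmas

  eqW-refl : ∀ {n} (u : Word n) → eqW u u ≡ true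
  eqW-refl u with Vec.≡-dec Fin._≟_ u u
  ... | yes _ = refl
  ... | no u≢u = ⊥-elim (u≢u refl)

  eqW-sound : ∀ {n} {u v : Word n} → eqW u v ≡ true → u ≡ v
  eqW-sound {u = u} {v} e with Vec.≡-dec Fin._≟_ u v
  ... | yes u≡v = u≡v

  ∈-words : ∀ {n} (w : Word n) → w ∈ words n
  ∈-words [] = here refl
  ∈-words {suc n} (x ∷ w) =
    ∈-concatMap⁺ (λ y → map (y ∷_) (words n)) {xs = x0 ∷ x1 ∷ x2 ∷ []} (Any.map (λ { refl → ∈-map⁺ (x ∷_) (∈-words w) }) (letter x))
    where
    letter : ∀ x → x ∈ x0 ∷ x1 ∷ x2 ∷ []
    letter zero = here refl
    letter (suc zero) = there (here refl)
    letter (suc (suc zero)) = there (there (here refl))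

  length-words : ∀ n → length (words n) ≡ 3 ^ n
  length-words zero = refl
  length-words (suc n) =
    trans (length-++ (wordsStartingWith x0)) (cong₂ _+_ (length-wordsStartingWith x0)
    (trans (length-++ (wordsStartingWith x1)) (cong₂ _+_ (length-wordsStartingWith x1)
    (trans (length-++ (wordsStartingWith x2)) (cong₂ _+_ (length-wordsStartingWith x2) refl)))))
    where
    wordsStartingWith : X → List (Word (suc n))
    wordsStartingWith x = map (x ∷_) (words n)
    length-wordsStartingWith : ∀ x → length (wordsStartingWith x) ≡ 3 ^ n
    length-wordsStartingWith x = trans (length-map (x ∷_) (words n)) (length-words n)

  words-unique : ∀ n → Unique (words n)
  words-unique zero = [] ∷ []
  words-unique (suc n) = unique-concatMap (λ x → map (x ∷_) (words n)) head letters-unique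
    (λ x → Unique.map⁺ (λ e → proj₂ (Vec.∷-injective e)) (words-unique n))
    (λ b∈ → let (_ , _ , b≡) = ∈-map⁻ _ b∈ in cong head b≡)
    where
    letters-unique : Unique (x0 ∷ x1 ∷ x2 ∷ [])
    letters-unique = ((λ ()) ∷ (λ ()) ∷ []) ∷ ((λ ()) ∷ []) ∷ [] ∷ []


  const-∷ʳ : ∀ n (i : X) → const (suc n) i ≡ const n i ∷ʳ i
  const-∷ʳ zero i = refl
  const-∷ʳ (suc n) i = cong (i ∷_) (const-∷ʳ n i)

  act-∷ʳ : ∀ s {n} (w : Word n) x → act s w ≢ w → act s (w ∷ʳ x) ≡ act s w ∷ʳ x
  act-∷ʳ s [] x s≢ = ⊥-elim (s≢ refl)
  act-∷ʳ ga (zero ∷ w) x _ = refl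
  act-∷ʳ ga (suc zero ∷ w) x _ = refl
  act-∷ʳ ga (suc (suc zero) ∷ w) x s≢ = cong (x2 ∷_) (act-∷ʳ ga w x (s≢ ∘ cong (x2 ∷_)))
  act-∷ʳ gb (zero ∷ w) x _ = refl
  act-∷ʳ gb (suc zero ∷ w) x s≢ = cong (x1 ∷_) (act-∷ʳ gb w x (s≢ ∘ cong (x1 ∷_)))
  act-∷ʳ gb (suc (suc zero) ∷ w) x _ = refl
  act-∷ʳ gc (zero ∷ w) x s≢ = cong (x0 ∷_) (act-∷ʳ gc w x (s≢ ∘ cong (x0 ∷_)))
  act-∷ʳ gc (suc zero ∷ w) x _ = refl
  act-∷ʳ gc (suc (suc zero) ∷ w) x _ = refl

  -- The letter that s stabilises and along which it recurses: a = (01)(id,id,a) fixes 2, and so on.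
  fixedLetter : Gen → X
  fixedLetter ga = x2
  fixedLetter gb = x1
  fixedLetter gc = x0

  act₁ : Gen → X → X
  act₁ s x = head (act s (x ∷ []))

  act-const : ∀ s {n} → act s (const n (fixedLetter s)) ≡ const n (fixedLetter s)
  act-const s {zero} = refl
  act-const ga {suc n} = cong (x2 ∷_) (act-const ga {n})
  act-const gb {suc n} = cong (x1 ∷_) (act-const gb {n})
  act-const gc {suc n} = cong (x0 ∷_) (act-const gc {n})

  act-const-∷ʳ : ∀ s {n} x → act s (const n (fixedLetter s) ∷ʳ x) ≡ const n (fixedLetter s) ∷ʳ act₁ s x
  act-const-∷ʳ ga {zero} zero = refl
  act-const-∷ʳ ga {zero} (suc zero) = refl
  act-const-∷ʳ ga {zero} (suc (suc zero)) = refl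
  act-const-∷ʳ gb {zero} zero = refl
  act-const-∷ʳ gb {zero} (suc zero) = refl
  act-const-∷ʳ gb {zero} (suc (suc zero)) = refl
  act-const-∷ʳ gc {zero} zero = refl
  act-const-∷ʳ gc {zero} (suc zero) = refl
  act-const-∷ʳ gc {zero} (suc (suc zero)) = refl
  act-const-∷ʳ ga {suc n} x = cong (x2 ∷_) (act-const-∷ʳ ga {n} x)
  act-const-∷ʳ gb {suc n} x = cong (x1 ∷_) (act-const-∷ʳ gb {n} x)
  act-const-∷ʳ gc {suc n} x = cong (x0 ∷_) (act-const-∷ʳ gc {n} x)

  fixed⇒const : ∀ s {n} (w : Word n) → act s w ≡ w → w ≡ const n (fixedLetter s)
  fixed⇒const s [] _ = refl
  fixed⇒const ga (zero ∷ w) ()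
  fixed⇒const ga (suc zero ∷ w) ()
  fixed⇒const ga (suc (suc zero) ∷ w) e = cong (x2 ∷_) (fixed⇒const ga w (proj₂ (Vec.∷-injective e)))
  fixed⇒const gb (zero ∷ w) ()
  fixed⇒const gb (suc zero ∷ w) e = cong (x1 ∷_) (fixed⇒const gb w (proj₂ (Vec.∷-injective e)))
  fixed⇒const gb (suc (suc zero) ∷ w) ()
  fixed⇒const gc (zero ∷ w) e = cong (x0 ∷_) (fixed⇒const gc w (proj₂ (Vec.∷-injective e)))
  fixed⇒const gc (suc zero ∷ w) ()
  fixed⇒const gc (suc (suc zero) ∷ w) ()

  <ᵇ-irrefl : ∀ m → (m <ᵇ m) ≡ false
  <ᵇ-irrefl zero = refl
  <ᵇ-irrefl (suc m) = <ᵇ-irrefl m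

  lexLess-irrefl : ∀ {n} (u : Word n) → lexLess u u ≡ false
  lexLess-irrefl [] = refl
  lexLess-irrefl (x ∷ u) with x Fin.≟ x
  ... | yes _ rewrite <ᵇ-irrefl (toℕ x) | lexLess-irrefl u = refl
  ... | no x≢x = ⊥-elim (x≢x refl)

  lexLess-∷ʳ-≢ : ∀ {n} (w w′ : Word n) y y′ → w ≢ w′ → lexLess (w ∷ʳ y) (w′ ∷ʳ y′) ≡ lexLess w w′
  lexLess-∷ʳ-≢ [] [] y y′ w≢ = ⊥-elim (w≢ refl)
  lexLess-∷ʳ-≢ (x ∷ w) (x′ ∷ w′) y y′ w≢ with x Fin.≟ x′
  ... | no _ = refl
  ... | yes refl = cong ((toℕ x <ᵇ toℕ x) ∨_) (lexLess-∷ʳ-≢ w w′ y y′ (w≢ ∘ cong (x ∷_)))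

  lexLess-∷ʳ-≡ : ∀ {n} (w : Word n) y y′ → lexLess (w ∷ʳ y) (w ∷ʳ y′) ≡ lexLess (y ∷ []) (y′ ∷ [])
  lexLess-∷ʳ-≡ [] y y′ = refl
  lexLess-∷ʳ-≡ (x ∷ w) y y′ with x Fin.≟ x
  ... | yes _ rewrite <ᵇ-irrefl (toℕ x) = lexLess-∷ʳ-≡ w y y′
  ... | no x≢x = ⊥-elim (x≢x refl)

module SchreierGraph where

  open import Data.Bool using (true; false; if_then_else_)
  open import Data.Empty using (⊥)
  open import Function using (_∘_)
  open import Data.Fin using (Fin; zero; suc)
  import Data.Fin as Fin
  open import Data.List using (List; []; _∷_; _++_; map; concatMap; foldr)
  open import Data.List.Membership.Propositional using (_∈_; _∉_; find)
  open import Data.List.Membership.Propositional.Properties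
    using (∈-map⁺; ∈-map⁻; ∈-++⁺ˡ; ∈-++⁺ʳ; ∈-++⁻; ∈-concatMap⁺; ∈-concatMap⁻)
  open import Data.List.Relation.Unary.Any using (here; there)
  import Data.List.Relation.Unary.Any as Any
  open import Data.List.Relation.Unary.All using (All; []; _∷_)
  open import Data.List.Relation.Unary.AllPairs using ([]; _∷_)
  open import Data.List.Relation.Unary.Unique.Propositional using (Unique)
  import Data.List.Relation.Unary.Unique.Propositional.Properties as Unique
  open import Data.List.Relation.Binary.Permutation.Propositional using (_↭_)
  open import Data.Nat using (ℕ; zero; suc)
  open import Data.Product using (_×_; _,_; Σ; proj₁; proj₂)
  open import Data.Sum using (_⊎_; inj₁; inj₂)
  open import Data.Vec using (Vec; []; _∷_; _∷ʳ_; initLast)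
  import Data.Vec.Properties as Vec
  open import Relation.Nullary using (yes; no)
  open import Relation.Binary.PropositionalEquality

  open import Defs
  open ListLemmas
  open Words

  NonLoop : ∀ {n} → Edge n → Set
  NonLoop (s , w) = act s w ≢ w

  generators : List Gen
  generators = ga ∷ gb ∷ gc ∷ []

  edgesOf : ∀ n → Gen → List (Edge n)
  edgesOf n s = concatMap (λ u → if lexLess u (act s u) then (s , u) ∷ [] else []) (words n)

  if-∈ : ∀ {A : Set} b {z y : A} → y ∈ (if b then z ∷ [] else []) → b ≡ true × y ≡ z
  if-∈ true (here y≡z) = refl , y≡z

  ∈edges⇒lexLess : ∀ {n} {s : Gen} {w : Word n} → (s , w) ∈ edges n → lexLess w (act s w) ≡ true
  ∈edges⇒lexLess {n} m with find (∈-concatMap⁻ (edgesOf n) {xs = generators} m)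
  ... | s′ , _ , m′ with find (∈-concatMap⁻ (λ u → if lexLess u (act s′ u) then (s′ , u) ∷ [] else []) {xs = words n} m′)
  ... | u , _ , m″ with if-∈ (lexLess u (act s′ u)) m″
  ... | lt , refl = lt

  lexLess⇒∈edges : ∀ {n} (s : Gen) (w : Word n) → lexLess w (act s w) ≡ true → (s , w) ∈ edges n
  lexLess⇒∈edges {n} s w lt = ∈-concatMap⁺ (edgesOf n) {xs = generators} (Any.map (λ { refl → ∈edgesOf }) (generator s))
    where
    generator : ∀ s → s ∈ generators
    generator ga = here refl
    generator gb = there (here refl)
    generator gc = there (there (here refl))
    ∈if : (s , w) ∈ (if lexLess w (act s w) then (s , w) ∷ [] else [])
    ∈if rewrite lt = here refl
    ∈edgesOf : (s , w) ∈ edgesOf n s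
    ∈edgesOf = ∈-concatMap⁺ _ {xs = words n} (Any.map (λ { refl → ∈if }) (∈-words w))

  ∈edges⇒nonLoop : ∀ {n} {e : Edge n} → e ∈ edges n → NonLoop e
  ∈edges⇒nonLoop {e = s , w} m s≡ with ∈edges⇒lexLess m
  ... | lt rewrite s≡ | lexLess-irrefl w with lt
  ... | ()

  edges-unique : ∀ n → Unique (edges n)
  edges-unique n = unique-concatMap (edgesOf n) proj₁ generators-unique
    (λ s → unique-concatMap _ proj₂ (words-unique n) (λ u → unique-if (lexLess u (act s u)))
       (λ {u} m → cong proj₂ (proj₂ (if-∈ (lexLess u (act s u)) m))))
    (λ {s} m → let (u , _ , m′) = find (∈-concatMap⁻ (λ u → if lexLess u (act s u) then (s , u) ∷ [] else []) {xs = words n} m)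
               in cong proj₁ (proj₂ (if-∈ (lexLess u (act s u)) m′)))
    where
    generators-unique : Unique generators
    generators-unique = ((λ ()) ∷ (λ ()) ∷ []) ∷ ((λ ()) ∷ []) ∷ [] ∷ []
    unique-if : ∀ {A : Set} b {z : A} → Unique (if b then z ∷ [] else [])
    unique-if true = [] ∷ []
    unique-if false = []

  copy : ∀ {n} → X → Edge n → Edge (suc n)
  copy x (s , w) = s , w ∷ʳ x

  copy-injective : ∀ {n} {x x′} {e e′ : Edge n} → copy x e ≡ copy x′ e′ → x ≡ x′ × e ≡ e′
  copy-injective {e = s , w} {s′ , w′} eq with cong proj₁ eq | Vec.∷ʳ-injective w w′ (cong proj₂ eq)
  ... | refl | refl , refl = refl , refl

  end₂-copy : ∀ {n} x {e : Edge n} → NonLoop e → end₂ (copy x e) ≡ end₂ e ∷ʳ x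
  end₂-copy x {s , w} = act-∷ʳ s w x

  -- The edges of Σ_{n+1} between different copies of Σ_n: {2ⁿ0, 2ⁿ1}, {1ⁿ0, 1ⁿ2} and {0ⁿ1, 0ⁿ2}, labelled a, b, c.
  data Bridge : Set where
    bridgeA bridgeB bridgeC : Bridge

  bridges : List Bridge
  bridges = bridgeA ∷ bridgeB ∷ bridgeC ∷ []

  bridgeGen : Bridge → Gen
  bridgeGen bridgeA = ga
  bridgeGen bridgeB = gb
  bridgeGen bridgeC = gc

  bridgeCopy : Bridge → X
  bridgeCopy bridgeA = x0
  bridgeCopy bridgeB = x0
  bridgeCopy bridgeC = x1

  bridgeLoop : ∀ n → Bridge → Edge n
  bridgeLoop n c = bridgeGen c , const n (fixedLetter (bridgeGen c))

  bridge : ∀ n → Bridge → Edge (suc n)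
  bridge n c = copy (bridgeCopy c) (bridgeLoop n c)

  ∈bridges : ∀ c → c ∈ bridges
  ∈bridges bridgeA = here refl
  ∈bridges bridgeB = there (here refl)
  ∈bridges bridgeC = there (there (here refl))

  bridge-injective : ∀ {n c c′} → bridge n c ≡ bridge n c′ → c ≡ c′
  bridge-injective {c = bridgeA} {bridgeA} _ = refl
  bridge-injective {c = bridgeB} {bridgeB} _ = refl
  bridge-injective {c = bridgeC} {bridgeC} _ = refl
  bridge-injective {c = bridgeA} {bridgeB} eq with cong proj₁ eq
  ... | ()
  bridge-injective {c = bridgeA} {bridgeC} eq with cong proj₁ eq
  ... | ()
  bridge-injective {c = bridgeB} {bridgeA} eq with cong proj₁ eq
  ... | ()
  bridge-injective {c = bridgeB} {bridgeC} eq with cong proj₁ eq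
  ... | ()
  bridge-injective {c = bridgeC} {bridgeA} eq with cong proj₁ eq
  ... | ()
  bridge-injective {c = bridgeC} {bridgeB} eq with cong proj₁ eq
  ... | ()

  copy≢bridge : ∀ {n} x {e : Edge n} c → NonLoop e → copy x e ≢ bridge n c
  copy≢bridge x c nonLoop eq with copy-injective eq
  ... | _ , refl = nonLoop (act-const (bridgeGen c))

  glue : ∀ {n} → (X → List (Edge n)) → List (Edge (suc n)) → List (Edge (suc n))
  glue Fs B = map (copy x0) (Fs x0) ++ (map (copy x1) (Fs x1) ++ (map (copy x2) (Fs x2) ++ B))

  glue-∈⁻ : ∀ {n} (Fs : X → List (Edge n)) B {z} → z ∈ glue Fs B →
    (Σ X λ x → Σ (Edge n) λ e → e ∈ Fs x × z ≡ copy x e) ⊎ z ∈ B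
  glue-∈⁻ Fs B m with ∈-++⁻ (map (copy x0) (Fs x0)) m
  ... | inj₁ m₀ = let (e , e∈ , eq) = ∈-map⁻ (copy x0) m₀ in inj₁ (x0 , e , e∈ , eq)
  ... | inj₂ m₁ with ∈-++⁻ (map (copy x1) (Fs x1)) m₁
  ... | inj₁ m₀ = let (e , e∈ , eq) = ∈-map⁻ (copy x1) m₀ in inj₁ (x1 , e , e∈ , eq)
  ... | inj₂ m₂ with ∈-++⁻ (map (copy x2) (Fs x2)) m₂
  ... | inj₁ m₀ = let (e , e∈ , eq) = ∈-map⁻ (copy x2) m₀ in inj₁ (x2 , e , e∈ , eq)
  ... | inj₂ m₃ = inj₂ m₃

  copy-∈-glue : ∀ {n} (Fs : X → List (Edge n)) B x {e} → e ∈ Fs x → copy x e ∈ glue Fs B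
  copy-∈-glue Fs B zero m = ∈-++⁺ˡ (∈-map⁺ (copy x0) m)
  copy-∈-glue Fs B (suc zero) m = ∈-++⁺ʳ (map (copy x0) (Fs x0)) (∈-++⁺ˡ (∈-map⁺ (copy x1) m))
  copy-∈-glue Fs B (suc (suc zero)) m =
    ∈-++⁺ʳ (map (copy x0) (Fs x0)) (∈-++⁺ʳ (map (copy x1) (Fs x1)) (∈-++⁺ˡ (∈-map⁺ (copy x2) m)))

  ∈-glueʳ : ∀ {n} (Fs : X → List (Edge n)) {B z} → z ∈ B → z ∈ glue Fs B
  ∈-glueʳ Fs m = ∈-++⁺ʳ (map (copy x0) (Fs x0)) (∈-++⁺ʳ (map (copy x1) (Fs x1)) (∈-++⁺ʳ (map (copy x2) (Fs x2)) m))

  glueEdges : ∀ n → List (Edge (suc n))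
  glueEdges n = glue (λ _ → edges n) (map (bridge n) bridges)

  lexLess-copy : ∀ {n} y (e : Edge n) → NonLoop e →
    lexLess (proj₂ (copy y e)) (act (proj₁ e) (proj₂ (copy y e))) ≡ lexLess (proj₂ e) (act (proj₁ e) (proj₂ e))
  lexLess-copy y (s , w) nonLoop rewrite act-∷ʳ s w y nonLoop = lexLess-∷ʳ-≢ w (act s w) y y (nonLoop ∘ sym)


  lexLess-bridge : ∀ n c → lexLess (proj₂ (bridge n c)) (act (bridgeGen c) (proj₂ (bridge n c))) ≡ true
  lexLess-bridge n bridgeA rewrite act-const-∷ʳ ga {n} x0 | lexLess-∷ʳ-≡ (const n x2) x0 x1 = refl
  lexLess-bridge n bridgeB rewrite act-const-∷ʳ gb {n} x0 | lexLess-∷ʳ-≡ (const n x1) x0 x2 = refl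
  lexLess-bridge n bridgeC rewrite act-const-∷ʳ gc {n} x1 | lexLess-∷ʳ-≡ (const n x0) x1 x2 = refl

  edges-suc-⊆ : ∀ {n} {z} → z ∈ edges (suc n) → z ∈ glueEdges n
  edges-suc-⊆ {n} {s , u} m with initLast u
  ... | w , y , refl with Vec.≡-dec Fin._≟_ (act s w) w
  ... | no nonLoop = copy-∈-glue _ _ y (lexLess⇒∈edges s w (trans (sym (lexLess-copy y (s , w) nonLoop)) (∈edges⇒lexLess m)))
  ... | yes fixed with fixed⇒const s w fixed
  ... | refl with ∈edges⇒lexLess m
  ... | lt rewrite act-const-∷ʳ s {n} y | lexLess-∷ʳ-≡ (const n (fixedLetter s)) y (act₁ s y) = bridgeCase s y lt
    where
    bridgeCase : ∀ s y → lexLess (y ∷ []) (act₁ s y ∷ []) ≡ true → (s , const n (fixedLetter s) ∷ʳ y) ∈ glueEdges n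
    bridgeCase ga zero _ = ∈-glueʳ (λ _ → edges n) (∈-map⁺ (bridge n) (∈bridges bridgeA))
    bridgeCase gb zero _ = ∈-glueʳ (λ _ → edges n) (∈-map⁺ (bridge n) (∈bridges bridgeB))
    bridgeCase gc (suc zero) _ = ∈-glueʳ (λ _ → edges n) (∈-map⁺ (bridge n) (∈bridges bridgeC))
    bridgeCase ga (suc zero) ()
    bridgeCase ga (suc (suc zero)) ()
    bridgeCase gb (suc zero) ()
    bridgeCase gb (suc (suc zero)) ()
    bridgeCase gc zero ()
    bridgeCase gc (suc (suc zero)) ()

  edges-suc-⊇ : ∀ {n} {z} → z ∈ glueEdges n → z ∈ edges (suc n)
  edges-suc-⊇ {n} m with glue-∈⁻ (λ _ → edges n) _ m
  ... | inj₁ (y , (s , w) , e∈ , refl) =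
    lexLess⇒∈edges s (w ∷ʳ y) (trans (lexLess-copy y (s , w) (∈edges⇒nonLoop e∈)) (∈edges⇒lexLess e∈))
  ... | inj₂ b∈ with ∈-map⁻ (bridge n) b∈
  ... | c , _ , refl = lexLess⇒∈edges (bridgeGen c) (proj₂ (bridge n c)) (lexLess-bridge n c)

  module _ (n : ℕ) where

    copies : List X → List (Edge (suc n))
    copies = foldr (λ y acc → map (copy y) (edges n) ++ acc) (map (bridge n) bridges)

    copy-∉-copies : ∀ {y ys e} → All (y ≢_) ys → e ∈ edges n → copy y e ∉ copies ys
    copy-∉-copies {e = e} [] e∈ m with ∈-map⁻ (bridge n) m
    ... | c , _ , eq = copy≢bridge _ c (∈edges⇒nonLoop e∈) eq
    copy-∉-copies {ys = y′ ∷ ys} (y≢y′ ∷ y≢ys) e∈ m with ∈-++⁻ (map (copy y′) (edges n)) m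
    ... | inj₂ m′ = copy-∉-copies y≢ys e∈ m′
    ... | inj₁ m′ with ∈-map⁻ (copy y′) m′
    ... | _ , _ , eq = y≢y′ (proj₁ (copy-injective eq))

    copies-unique : ∀ {ys} → Unique ys → Unique (copies ys)
    copies-unique [] = Unique.map⁺ bridge-injective (((λ ()) ∷ (λ ()) ∷ []) ∷ ((λ ()) ∷ []) ∷ [] ∷ [])
    copies-unique {y ∷ ys} (y≢ys ∷ u) =
      Unique.++⁺ (Unique.map⁺ (proj₂ ∘ copy-injective) (edges-unique n)) (copies-unique u) disjoint
      where

      disjoint : ∀ {z} → z ∈ map (copy y) (edges n) × z ∈ copies ys → ⊥
      disjoint (m , m′) with ∈-map⁻ (copy y) m
      ... | e , e∈ , refl = copy-∉-copies y≢ys e∈ m′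

  edges-suc-↭ : ∀ n → edges (suc n) ↭ glueEdges n
  edges-suc-↭ n = unique-⊆-⊇⇒↭ (edges-unique (suc n))
    (copies-unique n (((λ ()) ∷ (λ ()) ∷ []) ∷ ((λ ()) ∷ []) ∷ [] ∷ []))
    edges-suc-⊆ edges-suc-⊇

module Connectivity where

  open import Data.Bool using (Bool; true; false; _∧_; _∨_; not; if_then_else_)
  open import Data.Bool.ListAction using (all; any)
  open import Data.Empty using (⊥-elim)
  open import Data.List using (List; []; _∷_; length)
  open import Data.List.Membership.Propositional using (_∈_)
  open import Data.List.Relation.Unary.Any using (here; there)
  open import Data.List.Relation.Binary.Permutation.Propositional using (_↭_; ↭-sym; ↭-trans)
  open import Data.List.Relation.Binary.Permutation.Propositional.Properties using (∈-resp-↭; drop-∷)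
  open import Data.Nat using (ℕ; zero; suc; _^_; _≤_; z≤n; s≤s)
  open import Data.Nat.Properties using (≤-trans; m≤n⇒m≤1+n; <-irrefl)
  open import Data.Product using (_×_; _,_; Σ)
  open import Data.Sum using (_⊎_; inj₁; inj₂)
  open import Relation.Nullary using (¬_)
  open import Relation.Binary.PropositionalEquality
  open import Data.Bool.Properties using (⇔→≡; ¬-not)
  open import Function.Bundles using (mk⇔)
  open import Relation.Binary.Construct.Closure.ReflexiveTransitive using (Star; ε; _◅_; _◅◅_)
  import Relation.Binary.Construct.Closure.ReflexiveTransitive as Star

  open import Defs
  open ListLemmas
  open Words

  Link : ∀ {n} → Edge n → Word n → Word n → Set
  Link e u v = (end₁ e ≡ u × end₂ e ≡ v) ⊎ (end₁ e ≡ v × end₂ e ≡ u)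

  Adj : ∀ {n} → List (Edge n) → Word n → Word n → Set
  Adj {n} F u v = Σ (Edge n) λ e → e ∈ F × Link e u v

  Conn : ∀ {n} → List (Edge n) → Word n → Word n → Set
  Conn F = Star (Adj F)

  Link-sym : ∀ {n} {e : Edge n} {u v} → Link e u v → Link e v u
  Link-sym (inj₁ (p , q)) = inj₂ (p , q)
  Link-sym (inj₂ (p , q)) = inj₁ (p , q)

  Conn-sym : ∀ {n} {F : List (Edge n)} {u v} → Conn F u v → Conn F v u
  Conn-sym = Star.reverse λ { (e , e∈ , l) → e , e∈ , Link-sym l }

  Conn-mono : ∀ {n} {F G : List (Edge n)} → (∀ {e} → e ∈ F → e ∈ G) → ∀ {u v} → Conn F u v → Conn G u v
  Conn-mono F⊆G = Star.map λ { (e , e∈ , l) → e , F⊆G e∈ , l }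

  Conn-resp-↭ : ∀ {n} {F G : List (Edge n)} → F ↭ G → ∀ {u v} → Conn F u v → Conn G u v
  Conn-resp-↭ p = Conn-mono (∈-resp-↭ p)

  edge⇒Conn : ∀ {n} {F : List (Edge n)} {e} → e ∈ F → Conn F (end₁ e) (end₂ e)
  edge⇒Conn {e = e} e∈ = (e , e∈ , inj₁ (refl , refl)) ◅ ε

  -- conn F u v iterates the neighbourhood expansion 3ⁿ times; the reached set grows strictly until it
  -- stabilises and Σ_n has 3ⁿ vertices, so it is stable by then.
  module Reachability {n} (F : List (Edge n)) where

    reach : Word n → ℕ → Word n → Bool
    reach u k = iterate k (step F) (eqW u)

    step-⊇ : ∀ (S : Word n → Bool) v → S v ≡ true → step F S v ≡ true
    step-⊇ S v p rewrite p = refl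

    step-Adj : ∀ (S : Word n → Bool) {x y} → S x ≡ true → Adj F x y → step F S y ≡ true
    step-Adj S {y = y} sx (e , e∈ , inj₁ (refl , refl)) =
      ∨-trueʳ (S y) (any-true⁺ _ e∈ (∨-trueˡ _ (∧-true⁺ sx (eqW-refl (end₂ e)))))
    step-Adj S {y = y} sx (e , e∈ , inj₂ (refl , refl)) =
      ∨-trueʳ (S y) (any-true⁺ _ e∈ (∨-trueʳ (S (end₁ e) ∧ eqW (end₁ e) (end₂ e)) (∧-true⁺ sx (eqW-refl (end₁ e)))))

    reach-sound : ∀ u k v → reach u k v ≡ true → Conn F u v
    reach-sound u zero v p with eqW-sound {u = u} {v} p
    ... | refl = ε
    reach-sound u (suc k) v p with ∨-true⁻ {reach u k v} p
    ... | inj₁ q = reach-sound u k v q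
    ... | inj₂ q with any-true⁻ _ F q
    ... | e , e∈ , r with ∨-true⁻ r
    ... | inj₁ r₁ with ∧-true⁻ r₁
    ... | s₁ , s₂ = reach-sound u k (end₁ e) s₁ ◅◅ ((e , e∈ , inj₁ (refl , sym (eqW-sound {u = v} s₂))) ◅ ε)
    reach-sound u (suc k) v p | inj₂ q | e , e∈ , r | inj₂ r₂ with ∧-true⁻ r₂
    ... | s₁ , s₂ = reach-sound u k (end₂ e) s₁ ◅◅ ((e , e∈ , inj₂ (sym (eqW-sound {u = v} s₂) , refl)) ◅ ε)

    count : (Word n → Bool) → List (Word n) → ℕ
    count S [] = 0
    count S (x ∷ xs) = if S x then suc (count S xs) else count S xs

    count≤length : ∀ S xs → count S xs ≤ length xs
    count≤length S [] = z≤n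
    count≤length S (x ∷ xs) with S x
    ... | true = s≤s (count≤length S xs)
    ... | false = m≤n⇒m≤1+n (count≤length S xs)

    _⊆ᵇ_ : (Word n → Bool) → (Word n → Bool) → Set
    S ⊆ᵇ S′ = ∀ v → S v ≡ true → S′ v ≡ true

    count-mono : ∀ {S S′} → S ⊆ᵇ S′ → ∀ xs → count S xs ≤ count S′ xs
    count-mono h [] = z≤n
    count-mono {S} {S′} h (x ∷ xs) with S x in e₁ | S′ x in e₂
    ... | true | true = s≤s (count-mono h xs)
    ... | true | false with trans (sym (h x e₁)) e₂
    ... | ()
    count-mono h (x ∷ xs) | false | true = m≤n⇒m≤1+n (count-mono h xs)
    count-mono h (x ∷ xs) | false | false = count-mono h xs

    count-strict : ∀ {S S′} → S ⊆ᵇ S′ → ∀ {v} xs → v ∈ xs → S v ≡ false → S′ v ≡ true →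
      suc (count S xs) ≤ count S′ xs
    count-strict h (x ∷ xs) (here refl) f t rewrite f | t = s≤s (count-mono h xs)
    count-strict {S} {S′} h (x ∷ xs) (there v∈) f t with S x in e₁ | S′ x in e₂
    ... | true | true = s≤s (count-strict h xs v∈ f t)
    ... | true | false with trans (sym (h x e₁)) e₂
    ... | ()
    count-strict h (x ∷ xs) (there v∈) f t | false | true = m≤n⇒m≤1+n (count-strict h xs v∈ f t)
    count-strict h (x ∷ xs) (there v∈) f t | false | false = count-strict h xs v∈ f t

    count-pos : ∀ S {v} xs → v ∈ xs → S v ≡ true → 1 ≤ count S xs
    count-pos S (x ∷ xs) (here refl) t rewrite t = s≤s z≤n
    count-pos S (x ∷ xs) (there v∈) t with S x
    ... | true = s≤s z≤n
    ... | false = count-pos S xs v∈ t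

    Stable : (Word n → Bool) → Set
    Stable S = ∀ v → step F S v ≡ S v

    step-cong : ∀ {S S′} → (∀ v → S v ≡ S′ v) → ∀ v → step F S v ≡ step F S′ v
    step-cong h v = cong₂ _∨_ (h v)
      (any-cong F λ e → cong₂ _∨_ (cong (_∧ eqW v (end₂ e)) (h (end₁ e))) (cong (_∧ eqW v (end₁ e)) (h (end₂ e))))
      where
      any-cong : ∀ {p q : Edge n → Bool} xs → (∀ x → p x ≡ q x) → any p xs ≡ any q xs
      any-cong [] h = refl
      any-cong (x ∷ xs) h = cong₂ _∨_ (h x) (any-cong xs h)

    stable-or-grows : ∀ S → Stable S ⊎ (Σ (Word n) λ v → S v ≡ false × step F S v ≡ true)
    stable-or-grows S with all (λ v → not (step F S v) ∨ S v) (words n) in e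
    ... | true = inj₁ λ v → ⇔→≡ (mk⇔ (λ t → implied (step F S v) (S v) t (all-true⁻ _ e (∈-words v))) (step-⊇ S v))
      where
      implied : ∀ x y → x ≡ true → not x ∨ y ≡ true → y ≡ true
      implied true y refl p = p
    ... | false with all-false⁻ _ (words n) e
    ... | v , _ , q = inj₂ (v , counterexample (step F S v) (S v) q)
      where
      counterexample : ∀ x y → not x ∨ y ≡ false → y ≡ false × x ≡ true
      counterexample true false _ = refl , refl

    grows-or-stable : ∀ u k → suc k ≤ count (reach u k) (words n) ⊎ Stable (reach u k)
    grows-or-stable u zero = inj₁ (count-pos (eqW u) (words n) (∈-words u) (eqW-refl u))
    grows-or-stable u (suc k) with grows-or-stable u k
    ... | inj₂ st = inj₂ (step-cong st)
    ... | inj₁ c with stable-or-grows (reach u k)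
    ... | inj₁ st = inj₂ (step-cong st)
    ... | inj₂ (v , f , t) = inj₁ (≤-trans (s≤s c) (count-strict (step-⊇ (reach u k)) (words n) (∈-words v) f t))

    reach-stable : ∀ u → Stable (reach u (3 ^ n))
    reach-stable u with grows-or-stable u (3 ^ n)
    ... | inj₂ st = st
    ... | inj₁ c = ⊥-elim (<-irrefl refl (≤-trans c (subst (count (reach u (3 ^ n)) (words n) ≤_) (length-words n) (count≤length _ (words n)))))

    reach-self : ∀ u k → reach u k u ≡ true
    reach-self u zero = eqW-refl u
    reach-self u (suc k) = step-⊇ (reach u k) u (reach-self u k)

    reach-complete : ∀ u v → Conn F u v → reach u (3 ^ n) v ≡ true
    reach-complete u v p = closed p (reach-self u (3 ^ n))
      where
      closed : ∀ {x y} → Conn F x y → reach u (3 ^ n) x ≡ true → reach u (3 ^ n) y ≡ true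
      closed ε s = s
      closed (a ◅ p) s = closed p (trans (sym (reach-stable u _)) (step-Adj _ s a))

  conn-sound : ∀ {n} (F : List (Edge n)) u v → conn F u v ≡ true → Conn F u v
  conn-sound {n} F u v = Reachability.reach-sound F u (3 ^ n) v

  conn-complete : ∀ {n} (F : List (Edge n)) u v → Conn F u v → conn F u v ≡ true
  conn-complete F = Reachability.reach-complete F

  Acyclic : ∀ {n} → List (Edge n) → Set
  Acyclic {n} F = ∀ (e : Edge n) F′ → (e , F′) ∈ removals F → ¬ Conn F′ (end₁ e) (end₂ e)

  acyclic-sound : ∀ {n} (F : List (Edge n)) → acyclic F ≡ true → Acyclic F
  acyclic-sound F a e F′ m c with conn-complete F′ _ _ c | not-true⁻ (all-true⁻ _ a m)
  ... | t | f with trans (sym t) f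
  ... | ()

  acyclic-complete : ∀ {n} (F : List (Edge n)) → Acyclic F → acyclic F ≡ true
  acyclic-complete F h = all-true⁺ _ (removals F)
    λ { {e , F′} m → not-true⁺ (¬-not λ t → h e F′ m (conn-sound F′ _ _ t)) }

  Acyclic-resp-↭ : ∀ {n} {F G : List (Edge n)} → F ↭ G → Acyclic F → Acyclic G
  Acyclic-resp-↭ F↭G ac e L′ m c with ∈⇒removals (∈-resp-↭ (↭-sym F↭G) (removals-∈ m))
  ... | L , mL = ac e L mL (Conn-resp-↭ (↭-sym L↭L′) c)
    where
    L↭L′ : L ↭ L′
    L↭L′ = drop-∷ (↭-trans (↭-sym (removals-↭ mL)) (↭-trans F↭G (removals-↭ m)))

module ForestTypes where

  open import Data.Bool using (Bool; true; false; _∧_; _∨_; not; if_then_else_)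
  open import Data.Bool.ListAction using (all)
  open import Data.Empty using (⊥-elim)
  open import Data.Fin using (Fin; zero; suc)
  import Data.Fin as Fin
  import Data.Fin.Properties as Fin
  open import Data.List using (List)
  open import Data.List.Relation.Binary.Permutation.Propositional using (_↭_; ↭-sym)
  open import Data.Maybe using (Maybe; just; nothing)
  import Data.Maybe.Properties as Maybe
  open import Data.Nat using (ℕ)
  open import Data.Product using (_×_; _,_; Σ; proj₁; proj₂)
  open import Data.Sum using (_⊎_; inj₁; inj₂)
  open import Function.Bundles using (mk⇔)
  open import Relation.Nullary using (Dec; yes; does; ¬_)
  open import Relation.Nullary.Decidable using (dec-true; does-⇔)
  open import Relation.Binary.PropositionalEquality
  open import Data.Bool.Properties using (⇔→≡; ¬-not)
  open import Function using (_$_)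
  open import Relation.Binary.Construct.Closure.ReflexiveTransitive using (ε; _◅◅_)

  open import Defs
  open ListLemmas
  open Words
  open Connectivity

  dec-true⁻ : ∀ {A : Set} (d : Dec A) → does d ≡ true → A
  dec-true⁻ (yes a) _ = a

  -- The five ways the outmost vertices 0ⁿ, 1ⁿ, 2ⁿ can be distributed among the components of a
  -- spanning forest in which every component contains one of them; encoded in Fin 5 so that
  -- equality is decided by Fin._≟_.
  Partition : Set
  Partition = Fin 5

  pattern πT = zero
  pattern πU = suc zero
  pattern πR = suc (suc zero)
  pattern πL = suc (suc (suc zero))
  pattern πQ = suc (suc (suc (suc zero)))

  block : Partition → X → X
  block πT _ = x0
  block πU zero = x0
  block πU (suc zero) = x1
  block πU (suc (suc zero)) = x0
  block πR zero = x0
  block πR (suc zero) = x0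
  block πR (suc (suc zero)) = x2
  block πL zero = x0
  block πL (suc zero) = x1
  block πL (suc (suc zero)) = x1
  block πQ i = i

  sameBlock : Partition → X → X → Bool
  sameBlock π i j = does (block π i Fin.≟ block π j)

  sameBlock-refl : ∀ π i → sameBlock π i i ≡ true
  sameBlock-refl π i = dec-true (block π i Fin.≟ block π i) refl

  sameBlock-sym : ∀ π i j → sameBlock π i j ≡ sameBlock π j i
  sameBlock-sym π i j = does-⇔ (mk⇔ sym sym) (block π i Fin.≟ block π j) (block π j Fin.≟ block π i)

  sameBlock-trans : ∀ π i j k → sameBlock π i j ≡ true → sameBlock π j k ≡ true → sameBlock π i k ≡ true
  sameBlock-trans π i j k p q =
    dec-true (block π i Fin.≟ block π k) (trans (dec-true⁻ (block π i Fin.≟ block π j) p) (dec-true⁻ (block π j Fin.≟ block π k) q))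

  classify : Bool → Bool → Bool → Partition
  classify true true _ = πT
  classify true false _ = πR
  classify false true _ = πU
  classify false false true = πL
  classify false false false = πQ

  classify-01 : ∀ x y z → sameBlock (classify x y z) x0 x1 ≡ x
  classify-01 true true _ = refl
  classify-01 true false _ = refl
  classify-01 false true _ = refl
  classify-01 false false true = refl
  classify-01 false false false = refl

  classify-02 : ∀ x y z → sameBlock (classify x y z) x0 x2 ≡ y
  classify-02 true true _ = refl
  classify-02 true false _ = refl
  classify-02 false true _ = refl
  classify-02 false false true = refl
  classify-02 false false false = refl

  classify-12 : ∀ x y z → (x ≡ true → y ≡ true → z ≡ true) → (x ≡ true → z ≡ true → y ≡ true) →
    (y ≡ true → z ≡ true → x ≡ true) → sameBlock (classify x y z) x1 x2 ≡ z
  classify-12 true true z t₁ _ _ = sym (t₁ refl refl)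
  classify-12 true false true _ t₂ _ with t₂ refl refl
  ... | ()
  classify-12 true false false _ _ _ = refl
  classify-12 false true true _ _ t₃ with t₃ refl refl
  ... | ()
  classify-12 false true false _ _ _ = refl
  classify-12 false false true _ _ _ = refl
  classify-12 false false false _ _ _ = refl

  classify-sameBlock : ∀ π → classify (sameBlock π x0 x1) (sameBlock π x0 x2) (sameBlock π x1 x2) ≡ π
  classify-sameBlock πT = refl
  classify-sameBlock πU = refl
  classify-sameBlock πR = refl
  classify-sameBlock πL = refl
  classify-sameBlock πQ = refl

  module Classification (m : X → X → Bool) (m-refl : ∀ i → m i i ≡ true) (m-sym : ∀ i j → m i j ≡ m j i)
    (m-trans : ∀ i j k → m i j ≡ true → m j k ≡ true → m i k ≡ true) where

    π : Partition
    π = classify (m x0 x1) (m x0 x2) (m x1 x2)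

    classify-correct : ∀ i j → sameBlock π i j ≡ m i j
    classify-correct zero zero = trans (sameBlock-refl π x0) (sym (m-refl x0))
    classify-correct zero (suc zero) = classify-01 (m x0 x1) (m x0 x2) (m x1 x2)
    classify-correct zero (suc (suc zero)) = classify-02 (m x0 x1) (m x0 x2) (m x1 x2)
    classify-correct (suc zero) zero = trans (sameBlock-sym π x1 x0) (trans (classify-correct x0 x1) (m-sym x0 x1))
    classify-correct (suc zero) (suc zero) = trans (sameBlock-refl π x1) (sym (m-refl x1))
    classify-correct (suc zero) (suc (suc zero)) = classify-12 (m x0 x1) (m x0 x2) (m x1 x2)
      (λ p q → m-trans x1 x0 x2 (trans (m-sym x1 x0) p) q)
      (λ p q → m-trans x0 x1 x2 p q)
      (λ p q → m-trans x0 x2 x1 p (trans (m-sym x2 x1) q))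
    classify-correct (suc (suc zero)) zero = trans (sameBlock-sym π x2 x0) (trans (classify-correct x0 x2) (m-sym x0 x2))
    classify-correct (suc (suc zero)) (suc zero) = trans (sameBlock-sym π x2 x1) (trans (classify-correct x1 x2) (m-sym x1 x2))
    classify-correct (suc (suc zero)) (suc (suc zero)) = trans (sameBlock-refl π x2) (sym (m-refl x2))

  _≟ₜ_ : (s t : Maybe Partition) → Dec (s ≡ t)
  _≟ₜ_ = Maybe.≡-dec Fin._≟_

  isType : Partition → Maybe Partition → Bool
  isType π t = does (t ≟ₜ just π)

  isType-sound : ∀ π t → isType π t ≡ true → t ≡ just π
  isType-sound π t = dec-true⁻ (t ≟ₜ just π)

  isType-complete : ∀ π {t} → t ≡ just π → isType π t ≡ true
  isType-complete π {t} = dec-true (t ≟ₜ just π)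

  module _ {n : ℕ} (F : List (Edge n)) where

    connMatrix : X → X → Bool
    connMatrix i j = conn F (const n i) (const n j)

    cover : Bool
    cover = all (λ v → conn F (const n x0) v ∨ conn F (const n x1) v ∨ conn F (const n x2) v) (words n)

    typeOf : Maybe Partition
    typeOf = if acyclic F ∧ cover then just (classify (connMatrix x0 x1) (connMatrix x0 x2) (connMatrix x1 x2)) else nothing

    Rooted : Set
    Rooted = ∀ v → Σ X λ i → Conn F v (const n i)

    record IsForestOfType (π : Partition) : Set where
      constructor forestOfType
      field
        isAcyclic : Acyclic F
        connMatrix≡sameBlock : ∀ i j → connMatrix i j ≡ sameBlock π i j
        isRooted : Rooted

  module _ {n : ℕ} (F : List (Edge n)) where

    connMatrix-refl : ∀ i → connMatrix F i i ≡ true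
    connMatrix-refl i = conn-complete F (const n i) (const n i) ε

    connMatrix-sym : ∀ i j → connMatrix F i j ≡ connMatrix F j i
    connMatrix-sym i j = ⇔→≡ (mk⇔ (λ p → conn-complete F (const n j) (const n i) (Conn-sym (conn-sound F (const n i) (const n j) p)))
                                  (λ p → conn-complete F (const n i) (const n j) (Conn-sym (conn-sound F (const n j) (const n i) p))))

    connMatrix-trans : ∀ i j k → connMatrix F i j ≡ true → connMatrix F j k ≡ true → connMatrix F i k ≡ true
    connMatrix-trans i j k p q =
      conn-complete F (const n i) (const n k) (conn-sound F (const n i) (const n j) p ◅◅ conn-sound F (const n j) (const n k) q)

    open Classification (connMatrix F) connMatrix-refl connMatrix-sym connMatrix-trans

    Unrooted : Set
    Unrooted = Σ (Word n) λ w → ∀ j → ¬ Conn F w (const n j)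

    cover-sound : cover F ≡ true → Rooted F
    cover-sound c v with ∨-true⁻ (all-true⁻ _ c (∈-words v))
    ... | inj₁ p = x0 , Conn-sym (conn-sound F (const n x0) v p)
    ... | inj₂ q with ∨-true⁻ q
    ... | inj₁ p = x1 , Conn-sym (conn-sound F (const n x1) v p)
    ... | inj₂ p = x2 , Conn-sym (conn-sound F (const n x2) v p)

    joined⇒covered : ∀ {v} i → conn F (const n i) v ≡ true →
      (conn F (const n x0) v ∨ conn F (const n x1) v ∨ conn F (const n x2) v) ≡ true
    joined⇒covered {v} zero p = ∨-trueˡ _ p
    joined⇒covered {v} (suc zero) p = ∨-trueʳ (conn F (const n x0) v) (∨-trueˡ _ p)
    joined⇒covered {v} (suc (suc zero)) p = ∨-trueʳ (conn F (const n x0) v) (∨-trueʳ (conn F (const n x1) v) p)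

    cover-complete : (∀ v → Σ X λ i → conn F (const n i) v ≡ true) → cover F ≡ true
    cover-complete h = all-true⁺ _ (words n) λ {v} _ → joined⇒covered (proj₁ (h v)) (proj₂ (h v))

    Rooted⇒cover : Rooted F → cover F ≡ true
    Rooted⇒cover r = cover-complete λ v → proj₁ (r v) , conn-complete F (const n (proj₁ (r v))) v (Conn-sym (proj₂ (r v)))

    cover-false : cover F ≡ false → Unrooted
    cover-false c with all-false⁻ _ (words n) c
    ... | w , _ , f = w , λ j p → true≢false (trans (sym (joined⇒covered j (conn-complete F (const n j) w (Conn-sym p)))) f)

    typeOf-acyclic-cover : acyclic F ≡ true → cover F ≡ true → typeOf F ≡ just π
    typeOf-acyclic-cover a c with acyclic F | cover F
    typeOf-acyclic-cover refl refl | true | true = refl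

    typeOf-just⁻ : ∀ {π′} → typeOf F ≡ just π′ → IsForestOfType F π′
    typeOf-just⁻ eq with acyclic F in a | cover F in c
    typeOf-just⁻ refl | true | true =
      forestOfType (acyclic-sound F a) (λ i j → sym (classify-correct i j)) (cover-sound c)
    typeOf-just⁻ () | true | false
    typeOf-just⁻ () | false | _

    -- A partition is determined by which of the pairs 01, 02, 12 it joins.
    typeOf-bits : ∀ π′ → acyclic F ≡ true → cover F ≡ true → connMatrix F x0 x1 ≡ sameBlock π′ x0 x1 →
      connMatrix F x0 x2 ≡ sameBlock π′ x0 x2 → connMatrix F x1 x2 ≡ sameBlock π′ x1 x2 → typeOf F ≡ just π′
    typeOf-bits π′ a c p q r = trans (typeOf-acyclic-cover a c) (cong just (trans (cong₃ p q r) (classify-sameBlock π′)))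
      where
      cong₃ : ∀ {x y z x′ y′ z′} → x ≡ x′ → y ≡ y′ → z ≡ z′ → classify x y z ≡ classify x′ y′ z′
      cong₃ refl refl refl = refl

    typeOf-just⁺ : ∀ {π′} → IsForestOfType F π′ → typeOf F ≡ just π′
    typeOf-just⁺ {π′} (forestOfType ac m≡ rooted) =
      typeOf-bits π′ (acyclic-complete F ac) (Rooted⇒cover rooted) (m≡ x0 x1) (m≡ x0 x2) (m≡ x1 x2)

    typeOf-nothing⁺ : ¬ Acyclic F ⊎ Unrooted → typeOf F ≡ nothing
    typeOf-nothing⁺ bad with acyclic F in a | cover F in c
    ... | false | _ = refl
    ... | true | false = refl
    ... | true | true with bad
    ... | inj₁ ¬ac = ⊥-elim (¬ac (acyclic-sound F a))
    ... | inj₂ (w , ¬rooted) = let (i , p) = cover-sound c w in ⊥-elim (¬rooted i p)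

    typeOf-nothing⁻ : typeOf F ≡ nothing → ¬ Acyclic F ⊎ Unrooted
    typeOf-nothing⁻ eq with acyclic F in a | cover F in c
    typeOf-nothing⁻ () | true | true
    ... | true | false = inj₂ (cover-false c)
    ... | false | _ = inj₁ λ ac → true≢false (trans (sym (acyclic-complete F ac)) a)

  Conn⇒sameBlock : ∀ {n} {F : List (Edge n)} {π} → IsForestOfType F π → ∀ i j →
    Conn F (const n i) (const n j) → sameBlock π i j ≡ true
  Conn⇒sameBlock {F = F} (forestOfType _ m≡ _) i j p = trans (sym (m≡ i j)) (conn-complete F _ _ p)

  sameBlock⇒Conn : ∀ {n} {F : List (Edge n)} {π} → IsForestOfType F π → ∀ i j →
    sameBlock π i j ≡ true → Conn F (const n i) (const n j)
  sameBlock⇒Conn {n} {F} (forestOfType _ m≡ _) i j p = conn-sound F (const n i) (const n j) (trans (m≡ i j) p)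

  conn-resp-↭ : ∀ {n} {F G : List (Edge n)} → F ↭ G → ∀ u v → conn F u v ≡ conn G u v
  conn-resp-↭ {F = F} {G} F↭G u v = ⇔→≡ $ mk⇔
    (λ p → conn-complete G u v (Conn-resp-↭ F↭G (conn-sound F u v p)))
    (λ p → conn-complete F u v (Conn-resp-↭ (↭-sym F↭G) (conn-sound G u v p)))

  IsForestOfType-resp-↭ : ∀ {n} {F G : List (Edge n)} {π} → F ↭ G → IsForestOfType F π → IsForestOfType G π
  IsForestOfType-resp-↭ {n} F↭G (forestOfType ac m≡ rooted) = forestOfType
    (Acyclic-resp-↭ F↭G ac) (λ i j → trans (sym (conn-resp-↭ F↭G (const n i) (const n j))) (m≡ i j))
    (λ v → proj₁ (rooted v) , Conn-resp-↭ F↭G (proj₂ (rooted v)))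

  typeOf-resp-↭ : ∀ {n} {F G : List (Edge n)} → F ↭ G → typeOf F ≡ typeOf G
  typeOf-resp-↭ {F = F} {G} F↭G with typeOf F in eF | typeOf G in eG
  ... | just π | _ = trans (sym (typeOf-just⁺ G (IsForestOfType-resp-↭ F↭G (typeOf-just⁻ F eF)))) eG
  ... | nothing | nothing = refl
  ... | nothing | just π = trans (sym eF) (typeOf-just⁺ F (IsForestOfType-resp-↭ (↭-sym F↭G) (typeOf-just⁻ G eG)))

  forestPredicate : Partition → ∀ {n} → List (Edge n) → Bool
  forestPredicate πT = isTree
  forestPredicate πU {n} = isForest2 (const n x0) (const n x2) (const n x1)
  forestPredicate πR {n} = isForest2 (const n x0) (const n x1) (const n x2)
  forestPredicate πL {n} = isForest2 (const n x1) (const n x2) (const n x0)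
  forestPredicate πQ = isForest3

  module _ {n : ℕ} (F : List (Edge n)) where

    private
      m = connMatrix F

      m-sym : ∀ i j → m i j ≡ true → m j i ≡ true
      m-sym i j p = trans (connMatrix-sym F j i) p

    module FromType {π} (t : isType π (typeOf F) ≡ true) where
      forest : IsForestOfType F π
      forest = typeOf-just⁻ F (isType-sound π (typeOf F) t)

      open IsForestOfType forest public

      acyclic-true : acyclic F ≡ true
      acyclic-true = acyclic-complete F isAcyclic

      reached : ∀ j {v} l → sameBlock π j l ≡ true → Conn F v (const n l) → conn F (const n j) v ≡ true
      reached j {v} l q p = conn-complete F (const n j) v (sameBlock⇒Conn forest j l q ◅◅ Conn-sym p)

      covered-by : ∀ i k → (∀ l → sameBlock π i l ≡ true ⊎ sameBlock π k l ≡ true) →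
        all (λ v → conn F (const n i) v ∨ conn F (const n k) v) (words n) ≡ true
      covered-by i k choose = all-true⁺ _ (words n) λ {v} _ → let (l , p) = isRooted v in case l p (choose l)
        where
        case : ∀ {v} l → Conn F v (const n l) → sameBlock π i l ≡ true ⊎ sameBlock π k l ≡ true →
          (conn F (const n i) v ∨ conn F (const n k) v) ≡ true
        case l p (inj₁ q) = ∨-trueˡ _ (reached i l q p)
        case {v} l p (inj₂ q) = ∨-trueʳ (conn F (const n i) v) (reached k l q p)

    isTree-type : isTree F ≡ isType πT (typeOf F)
    isTree-type = ⇔→≡ (mk⇔ to from)
      where
      to : isTree F ≡ true → isType πT (typeOf F) ≡ true
      to t with ∧-true⁻ {acyclic F} t
      ... | a , al = isType-complete πT (typeOf-bits F πT a (cover-complete F λ v → x0 , all-true⁻ _ al (∈-words v)) p01 p02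
                       (connMatrix-trans F x1 x0 x2 (m-sym x0 x1 p01) p02))
        where
        p01 = all-true⁻ _ al (∈-words (const n x1))
        p02 = all-true⁻ _ al (∈-words (const n x2))
      from : isType πT (typeOf F) ≡ true → isTree F ≡ true
      from t = ∧-true⁺ acyclic-true (all-true⁺ _ (words n) λ {v} _ → let (l , p) = isRooted v in reached x0 l refl p)
        where open FromType t

    isForest2-type : ∀ π i j k →
      (m i j ≡ true → m i k ≡ false → m x0 x1 ≡ sameBlock π x0 x1 × m x0 x2 ≡ sameBlock π x0 x2 × m x1 x2 ≡ sameBlock π x1 x2) →
      sameBlock π i j ≡ true → sameBlock π i k ≡ false → (∀ l → sameBlock π i l ≡ true ⊎ sameBlock π k l ≡ true) →
      isForest2 (const n i) (const n j) (const n k) F ≡ isType π (typeOf F)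
    isForest2-type π i j k bits π-ij π-ik choose = ⇔→≡ (mk⇔ to from)
      where
      to : isForest2 (const n i) (const n j) (const n k) F ≡ true → isType π (typeOf F) ≡ true
      to t with ∧-true⁻ {acyclic F} t
      ... | a , t₁ with ∧-true⁻ {m i j} t₁
      ... | ij , t₂ with ∧-true⁻ {not (m i k)} t₂
      ... | ¬ik , al with bits ij (not-true⁻ ¬ik)
      ... | p01 , p02 , p12 = isType-complete π (typeOf-bits F π a (cover-complete F covered) p01 p02 p12)
        where
        covered : ∀ v → Σ X λ l → conn F (const n l) v ≡ true
        covered v with ∨-true⁻ (all-true⁻ _ al (∈-words v))
        ... | inj₁ p = i , p
        ... | inj₂ p = k , p
      from : isType π (typeOf F) ≡ true → isForest2 (const n i) (const n j) (const n k) F ≡ true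
      from t = ∧-true⁺ acyclic-true (∧-true⁺ (trans (connMatrix≡sameBlock i j) π-ij)
                 (∧-true⁺ (not-true⁺ (trans (connMatrix≡sameBlock i k) π-ik)) (covered-by i k choose)))
        where open FromType t

    isForest3-type : isForest3 F ≡ isType πQ (typeOf F)
    isForest3-type = ⇔→≡ (mk⇔ to from)
      where
      to : isForest3 F ≡ true → isType πQ (typeOf F) ≡ true
      to t with ∧-true⁻ {acyclic F} t
      ... | a , t₁ with ∧-true⁻ {not (m x0 x1)} t₁
      ... | ¬01 , t₂ with ∧-true⁻ {not (m x0 x2)} t₂
      ... | ¬02 , t₃ with ∧-true⁻ {not (m x1 x2)} t₃
      ... | ¬12 , c = isType-complete πQ (typeOf-bits F πQ a c (not-true⁻ ¬01) (not-true⁻ ¬02) (not-true⁻ ¬12))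
      from : isType πQ (typeOf F) ≡ true → isForest3 F ≡ true
      from t = ∧-true⁺ acyclic-true (∧-true⁺ (not-true⁺ (connMatrix≡sameBlock x0 x1)) (∧-true⁺ (not-true⁺ (connMatrix≡sameBlock x0 x2))
                 (∧-true⁺ (not-true⁺ (connMatrix≡sameBlock x1 x2)) (Rooted⇒cover F isRooted))))
        where open FromType t

    forestPredicate-type : ∀ π → forestPredicate π F ≡ isType π (typeOf F)
    forestPredicate-type πT = isTree-type
    forestPredicate-type πU = isForest2-type πU x0 x2 x1
      (λ p q → q , p , ¬-not λ r → true≢false (trans (sym (connMatrix-trans F x0 x2 x1 p (m-sym x1 x2 r))) q))
      refl refl λ { zero → inj₁ refl ; (suc zero) → inj₂ refl ; (suc (suc zero)) → inj₁ refl }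
    forestPredicate-type πR = isForest2-type πR x0 x1 x2
      (λ p q → p , q , ¬-not λ r → true≢false (trans (sym (connMatrix-trans F x0 x1 x2 p r)) q))
      refl refl λ { zero → inj₁ refl ; (suc zero) → inj₁ refl ; (suc (suc zero)) → inj₂ refl }
    forestPredicate-type πL = isForest2-type πL x1 x2 x0
      (λ p q → ¬-not (λ r → true≢false (trans (sym (m-sym x0 x1 r)) q)) ,
               ¬-not (λ r → true≢false (trans (sym (connMatrix-trans F x1 x2 x0 p (m-sym x0 x2 r))) q)) , p)
      refl refl λ { zero → inj₂ refl ; (suc zero) → inj₁ refl ; (suc (suc zero)) → inj₁ refl }
    forestPredicate-type πQ = isForest3-type

module Gluing where

  open import Data.Bool using (true; false)
  open import Data.Empty using (⊥; ⊥-elim)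
  open import Function using (_∘_)
  open import Data.Fin using (Fin; zero; suc)
  import Data.Fin as Fin
  open import Data.List using (List; map)
  open import Data.List.Membership.Propositional using (_∈_)
  open import Data.List.Membership.Propositional.Properties using (∈-map⁺; ∈-map⁻)
  open import Data.Nat using (zero; suc)
  open import Data.Product using (_×_; _,_; Σ; proj₁; proj₂)
  open import Data.Sum using (_⊎_; inj₁; inj₂)
  open import Data.Vec using (Vec; _∷ʳ_; initLast)
  import Data.Vec.Properties as Vec
  open import Relation.Nullary using (¬_; Dec; yes; no)
  open import Relation.Binary.PropositionalEquality
  open import Relation.Binary.Construct.Closure.ReflexiveTransitive using (Star; ε; _◅_; _◅◅_)
  import Relation.Binary.Construct.Closure.ReflexiveTransitive as Star

  open import Defs
  open ListLemmas
  open Words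
  open SchreierGraph
  open Connectivity
  open ForestTypes

  -- A port (x , j) is the corner jⁿx of the x-th copy of Σ_n inside Σ_{n+1}.
  Port : Set
  Port = X × X

  port : ∀ {n} → Port → Word (suc n)
  port {n} (x , j) = const n j ∷ʳ x

  bridgePorts : Bridge → Port × Port
  bridgePorts c = (bridgeCopy c , fixedLetter (bridgeGen c)) , (act₁ (bridgeGen c) (bridgeCopy c) , fixedLetter (bridgeGen c))

  bridge-ends : ∀ {n} c → end₁ (bridge n c) ≡ port (proj₁ (bridgePorts c)) × end₂ (bridge n c) ≡ port (proj₂ (bridgePorts c))
  bridge-ends c = refl , act-const-∷ʳ (bridgeGen c) (bridgeCopy c)

  Link-bridge⁻ : ∀ {n} c {w x w′ x′} → Link (bridge n c) (w ∷ʳ x) (w′ ∷ʳ x′) →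
    Σ X λ j → Σ X λ k → w ≡ const n j × w′ ≡ const n k × Link (bridge n c) (port (x , j)) (port (x′ , k))
  Link-bridge⁻ {n} c {w} {x} {w′} {x′} l with bridge-ends {n} c | l
  ... | e₁ , e₂ | inj₁ (p₁ , p₂) with Vec.∷ʳ-injective w _ (trans (sym p₁) e₁) | Vec.∷ʳ-injective w′ _ (trans (sym p₂) e₂)
  ... | refl , _ | refl , _ = _ , _ , refl , refl , l
  Link-bridge⁻ {n} c {w} {x} {w′} {x′} l | e₁ , e₂ | inj₂ (p₁ , p₂)
    with Vec.∷ʳ-injective w _ (trans (sym p₂) e₂) | Vec.∷ʳ-injective w′ _ (trans (sym p₁) e₁)
  ... | refl , _ | refl , _ = _ , _ , refl , refl , l

  module Glue {n} (Fs : X → List (Edge n)) (Cs : List Bridge) (nonLoop : ∀ x {e} → e ∈ Fs x → NonLoop e) where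

    G : List (Edge (suc n))
    G = glue Fs (map (bridge n) Cs)

    PortAdj : Port → Port → Set
    PortAdj p q = (proj₁ p ≡ proj₁ q × Conn (Fs (proj₁ p)) (const n (proj₂ p)) (const n (proj₂ q)))
                ⊎ (Σ Bridge λ c → c ∈ Cs × Link (bridge n c) (port p) (port q))

    PortConn : Port → Port → Set
    PortConn = Star PortAdj

    PortAdj-sym : ∀ {p q} → PortAdj p q → PortAdj q p
    PortAdj-sym (inj₁ (refl , c)) = inj₁ (refl , Conn-sym c)
    PortAdj-sym (inj₂ (c , c∈ , l)) = inj₂ (c , c∈ , Link-sym l)

    PortConn-sym : ∀ {p q} → PortConn p q → PortConn q p
    PortConn-sym = Star.reverse PortAdj-sym

    inCopy : ∀ x {j k} → Conn (Fs x) (const n j) (const n k) → PortAdj (x , j) (x , k)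
    inCopy x c = inj₁ (refl , c)

    Link-copy⁻ : ∀ y {e} → e ∈ Fs y → ∀ {w x w′ x′} → Link (copy y e) (w ∷ʳ x) (w′ ∷ʳ x′) →
      y ≡ x × y ≡ x′ × Link e w w′
    Link-copy⁻ y e∈ {w} {x} {w′} {x′} (inj₁ (p₁ , p₂))
      with Vec.∷ʳ-injective _ w p₁ | Vec.∷ʳ-injective _ w′ (trans (sym (end₂-copy y (nonLoop y e∈))) p₂)
    ... | a₁ , b₁ | a₂ , b₂ = b₁ , b₂ , inj₁ (a₁ , a₂)
    Link-copy⁻ y e∈ {w} {x} {w′} {x′} (inj₂ (p₁ , p₂))
      with Vec.∷ʳ-injective _ w′ p₁ | Vec.∷ʳ-injective _ w (trans (sym (end₂-copy y (nonLoop y e∈))) p₂)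
    ... | a₁ , b₁ | a₂ , b₂ = b₂ , b₁ , inj₂ (a₁ , a₂)

    Route : Word n → X → Word n → X → Set
    Route w x w′ x′ = (x ≡ x′ × Conn (Fs x) w w′)
      ⊎ (Σ X λ j → Σ X λ j′ → Conn (Fs x) w (const n j) × PortConn (x , j) (x′ , j′) × Conn (Fs x′) (const n j′) w′)

    Conn-glue⁻ : ∀ {u v} → Conn G u v → ∀ {w x w′ x′} → u ≡ w ∷ʳ x → v ≡ w′ ∷ʳ x′ → Route w x w′ x′
    Conn-glue⁻ ε eu ev with Vec.∷ʳ-injective _ _ (trans (sym eu) ev)
    ... | refl , refl = inj₁ (refl , ε)
    Conn-glue⁻ (_◅_ {j = u₁} (e , e∈ , l) p) refl ev with initLast u₁
    ... | w₁ , x₁ , refl with Conn-glue⁻ p refl ev | glue-∈⁻ Fs _ e∈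
    ... | rest | inj₁ (y , e₀ , e₀∈ , refl) with Link-copy⁻ y e₀∈ l
    ... | refl , refl , l₀ = prepend (e₀ , e₀∈ , l₀) rest
      where
      prepend : ∀ {x w w₁ w′ x′} → Adj (Fs x) w w₁ → Route w₁ x w′ x′ → Route w x w′ x′
      prepend a (inj₁ (eq , c)) = inj₁ (eq , a ◅ c)
      prepend a (inj₂ (j , j′ , c₁ , pc , c₂)) = inj₂ (j , j′ , a ◅ c₁ , pc , c₂)
    Conn-glue⁻ (_◅_ {j = u₁} (e , e∈ , l) p) refl ev | w₁ , x₁ , refl | rest | inj₂ b∈ with ∈-map⁻ (bridge n) b∈
    ... | c , c∈ , refl with Link-bridge⁻ c l
    ... | j , k , refl , refl , l′ = enter (inj₂ (c , c∈ , l′)) rest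
      where
      enter : ∀ {x j x₁ k w′ x′} → PortAdj (x , j) (x₁ , k) → Route (const n k) x₁ w′ x′ → Route (const n j) x w′ x′
      enter a (inj₁ (refl , c)) = inj₂ (_ , _ , ε , a ◅ ε , c)
      enter {x₁ = x₁} a (inj₂ (j₂ , j′ , c₁ , pc , c₂)) = inj₂ (_ , j′ , ε , a ◅ (inCopy x₁ c₁ ◅ pc) , c₂)

    Conn-copy⁺ : ∀ x {w w′} → Conn (Fs x) w w′ → Conn G (w ∷ʳ x) (w′ ∷ʳ x)
    Conn-copy⁺ x = Star.gmap (_∷ʳ x) lift
      where
      lift : ∀ {a b} → Adj (Fs x) a b → Adj G (a ∷ʳ x) (b ∷ʳ x)
      lift (e , e∈ , inj₁ (p₁ , p₂)) =
        copy x e , copy-∈-glue Fs _ x e∈ , inj₁ (cong (_∷ʳ x) p₁ , trans (end₂-copy x (nonLoop x e∈)) (cong (_∷ʳ x) p₂))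
      lift (e , e∈ , inj₂ (p₁ , p₂)) =
        copy x e , copy-∈-glue Fs _ x e∈ , inj₂ (cong (_∷ʳ x) p₁ , trans (end₂-copy x (nonLoop x e∈)) (cong (_∷ʳ x) p₂))

    PortConn⇒Conn : ∀ {p q} → PortConn p q → Conn G (port p) (port q)
    PortConn⇒Conn ε = ε
    PortConn⇒Conn (inj₁ (refl , c) ◅ r) = Conn-copy⁺ _ c ◅◅ PortConn⇒Conn r
    PortConn⇒Conn (inj₂ (c , c∈ , l) ◅ r) = (bridge n c , ∈-glueʳ Fs (∈-map⁺ (bridge n) c∈) , l) ◅ PortConn⇒Conn r

    Conn⇒PortConn : ∀ {p q} → Conn G (port p) (port q) → PortConn p q
    Conn⇒PortConn {x , j} {x′ , j′} c with Conn-glue⁻ c refl refl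
    ... | inj₁ (refl , c′) = inCopy x c′ ◅ ε
    ... | inj₂ (k , k′ , c₁ , pc , c₂) = inCopy x c₁ ◅ (pc ◅◅ (inCopy x′ c₂ ◅ ε))

  module _ {V : Set} (R : V → V → Set) (S : V → Set) where

    Outside : V → V → Set
    Outside a b = ¬ S a × ¬ S b × R a b

  module _ {V : Set} {R : V → V → Set} (S : V → Set) (S? : ∀ v → Dec (S v)) where

    private
      exit-or-outside : ∀ {s t} → Star R s t → ¬ S t →
        (Star (Outside R S) s t × ¬ S s) ⊎ (Σ V λ s′ → Σ V λ q → S s′ × R s′ q × ¬ S q × Star (Outside R S) q t)
      exit-or-outside ε ¬t = inj₁ (ε , ¬t)
      exit-or-outside {s} (r ◅ p) ¬t with exit-or-outside p ¬t
      ... | inj₂ exit = inj₂ exit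
      ... | inj₁ (out , ¬s₁) with S? s
      ... | yes ss = inj₂ (s , _ , ss , r , ¬s₁ , out)
      ... | no ¬s = inj₁ ((¬s , ¬s₁ , r) ◅ out , ¬s)

    last-exit : ∀ {s t} → Star R s t → S s → ¬ S t →
      Σ V λ s′ → Σ V λ q → S s′ × R s′ q × ¬ S q × Star (Outside R S) q t
    last-exit p ss ¬t with exit-or-outside p ¬t
    ... | inj₁ (_ , ¬s) = ⊥-elim (¬s ss)
    ... | inj₂ exit = exit

  update : ∀ {A : Set} → (X → A) → X → A → X → A
  update f y a x with x Fin.≟ y
  ... | yes _ = a
  ... | no _ = f x

  update-≡ : ∀ {A : Set} (f : X → A) y a → update f y a y ≡ a
  update-≡ f y a with y Fin.≟ y
  ... | yes _ = refl
  ... | no y≢y = ⊥-elim (y≢y refl)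

  update-⊆ : ∀ {n} (Fs : X → List (Edge n)) y {F′} → (∀ {z} → z ∈ F′ → z ∈ Fs y) →
    ∀ x {z} → z ∈ update Fs y F′ x → z ∈ Fs x
  update-⊆ Fs y F′⊆ x with x Fin.≟ y
  ... | yes refl = F′⊆
  ... | no _ = λ z∈ → z∈

  removals-glue⁻ : ∀ {n} (Fs : X → List (Edge n)) B {e G′} → (e , G′) ∈ removals (glue Fs B) →
    (Σ X λ y → Σ (Edge n) λ e₀ → Σ (List (Edge n)) λ F′ → (e₀ , F′) ∈ removals (Fs y) × e ≡ copy y e₀ × G′ ≡ glue (update Fs y F′) B)
    ⊎ (Σ (List (Edge (suc n))) λ B′ → (e , B′) ∈ removals B × G′ ≡ glue Fs B′)
  removals-glue⁻ Fs B m with removals-++⁻ (map (copy x0) (Fs x0)) _ m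
  ... | inj₁ (_ , m₁ , refl) with removals-map⁻ (copy x0) (Fs x0) m₁
  ... | e₀ , F′ , m₀ , refl , refl = inj₁ (x0 , e₀ , F′ , m₀ , refl , refl)
  removals-glue⁻ Fs B m | inj₂ (_ , m₂ , refl) with removals-++⁻ (map (copy x1) (Fs x1)) _ m₂
  ... | inj₁ (_ , m₁ , refl) with removals-map⁻ (copy x1) (Fs x1) m₁
  ... | e₀ , F′ , m₀ , refl , refl = inj₁ (x1 , e₀ , F′ , m₀ , refl , refl)
  removals-glue⁻ Fs B m | inj₂ (_ , m₂ , refl) | inj₂ (_ , m₃ , refl) with removals-++⁻ (map (copy x2) (Fs x2)) _ m₃
  ... | inj₁ (_ , m₁ , refl) with removals-map⁻ (copy x2) (Fs x2) m₁
  ... | e₀ , F′ , m₀ , refl , refl = inj₁ (x2 , e₀ , F′ , m₀ , refl , refl)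
  removals-glue⁻ Fs B m | inj₂ (_ , m₂ , refl) | inj₂ (_ , m₃ , refl) | inj₂ (B′ , m₄ , refl) = inj₂ (B′ , m₄ , refl)

  removals-glue-copy : ∀ {n} (Fs : X → List (Edge n)) B y {e₀ F′} → (e₀ , F′) ∈ removals (Fs y) →
    (copy y e₀ , glue (update Fs y F′) B) ∈ removals (glue Fs B)
  removals-glue-copy Fs B zero m = removals-++ˡ _ (removals-map⁺ (copy x0) m)
  removals-glue-copy Fs B (suc zero) m = removals-++ʳ (map (copy x0) (Fs x0)) (removals-++ˡ _ (removals-map⁺ (copy x1) m))
  removals-glue-copy Fs B (suc (suc zero)) m =
    removals-++ʳ (map (copy x0) (Fs x0)) (removals-++ʳ (map (copy x1) (Fs x1)) (removals-++ˡ _ (removals-map⁺ (copy x2) m)))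

  removals-glue-bridges : ∀ {n} (Fs : X → List (Edge n)) B {e B′} → (e , B′) ∈ removals B → (e , glue Fs B′) ∈ removals (glue Fs B)
  removals-glue-bridges Fs B m =
    removals-++ʳ (map (copy x0) (Fs x0)) (removals-++ʳ (map (copy x1) (Fs x1)) (removals-++ʳ (map (copy x2) (Fs x2)) m))

  -- Corners of Σ_n are distinct only for n ≥ 1; this is why the recursion starts at n = 1.
  port-injective : ∀ {m} {p q : Port} → port {suc m} p ≡ port q → p ≡ q
  port-injective {m} {x , j} {y , k} eq with Vec.∷ʳ-injective (const (suc m) j) (const (suc m) k) eq
  ... | refl , refl = refl

  Link-ends : ∀ {k} {e : Edge k} {u v u′ v′} → Link e u v → Link e u′ v′ → u ≡ u′ ⊎ u ≡ v′
  Link-ends (inj₁ (a₁ , _)) (inj₁ (b₁ , _)) = inj₁ (trans (sym a₁) b₁)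
  Link-ends (inj₁ (a₁ , _)) (inj₂ (b₁ , _)) = inj₂ (trans (sym a₁) b₁)
  Link-ends (inj₂ (_ , a₂)) (inj₁ (_ , b₂)) = inj₂ (trans (sym a₂) b₂)
  Link-ends (inj₂ (_ , a₂)) (inj₂ (_ , b₂)) = inj₁ (trans (sym a₂) b₂)

  module GlueAcyclic {m} (Fs : X → List (Edge (suc m))) (Cs : List Bridge) (nonLoop : ∀ x {e} → e ∈ Fs x → NonLoop e) where
    open Glue Fs Cs nonLoop

    BridgesAcyclic : Set
    BridgesAcyclic = ∀ c Cs′ → (c , Cs′) ∈ removals Cs → ∀ p q →
      Link (bridge (suc m) c) (port p) (port q) → ¬ Glue.PortConn Fs Cs′ nonLoop p q

    Acyclic⇒BridgesAcyclic : Acyclic G → BridgesAcyclic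
    Acyclic⇒BridgesAcyclic ac c Cs′ c∈ p q l pc =
      ac (bridge _ c) (glue Fs (map (bridge _) Cs′)) (removals-glue-bridges Fs _ (removals-map⁺ (bridge _) c∈)) (ends l)
      where
      joined : Conn (glue Fs (map (bridge _) Cs′)) (port p) (port q)
      joined = Glue.PortConn⇒Conn Fs Cs′ nonLoop pc
      ends : Link (bridge (suc m) c) (port p) (port q) → Conn (glue Fs (map (bridge _) Cs′)) (end₁ (bridge _ c)) (end₂ (bridge _ c))
      ends (inj₁ (a , b)) = subst₂ (Conn _) (sym a) (sym b) joined
      ends (inj₂ (a , b)) = subst₂ (Conn _) (sym a) (sym b) (Conn-sym joined)

    module WithoutEdge (y : X) (e₀ : Edge (suc m)) (F′ : List (Edge (suc m))) (e₀∈ : (e₀ , F′) ∈ removals (Fs y)) where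
      Fs′ : X → List (Edge (suc m))
      Fs′ = update Fs y F′

      Fs′⊆Fs : ∀ x {z} → z ∈ Fs′ x → z ∈ Fs x
      Fs′⊆Fs = update-⊆ Fs y (removals-⊆ e₀∈)

      nonLoop′ : ∀ x {e} → e ∈ Fs′ x → NonLoop e
      nonLoop′ x z∈ = nonLoop x (Fs′⊆Fs x z∈)

      Fs′-y : Fs′ y ≡ F′
      Fs′-y = update-≡ Fs y F′

      Side : Port → Set
      Side p = proj₁ p ≡ y × Conn F′ (const _ (proj₂ p)) (end₁ e₀)

      Side? : ∀ p → Dec (Side p)
      Side? (x , k) with x Fin.≟ y
      ... | no x≢y = no (x≢y ∘ proj₁)
      ... | yes refl with conn F′ (const _ k) (end₁ e₀) in eq
      ... | true = yes (refl , conn-sound F′ _ _ eq)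
      ... | false = no λ s → true≢false (trans (sym (conn-complete F′ _ _ (proj₂ s))) eq)

    Acyclic⇒copyAcyclic : Acyclic G → ∀ y → Acyclic (Fs y)
    Acyclic⇒copyAcyclic ac y e₀ F′ e₀∈ c =
      ac (copy y e₀) (glue (update Fs y F′) (map (bridge _) Cs)) (removals-glue-copy Fs _ y e₀∈)
         (subst (Conn _ _) (sym (end₂-copy y (nonLoop y (removals-∈ e₀∈))))
           (Glue.Conn-copy⁺ Fs′ Cs nonLoop′ y (subst (λ L → Conn L (end₁ e₀) (end₂ e₀)) (sym Fs′-y) c)))
      where open WithoutEdge y e₀ F′ e₀∈

    -- A cycle through a copy edge e₀ either stays in its copy or leaves it; in the latter case the last
    -- exit from e₀'s side of the copy is through a bridge whose endpoints the rest of the cycle joins.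
    Acyclic-glue : (∀ y → Acyclic (Fs y)) → BridgesAcyclic → Acyclic G
    Acyclic-glue acs ab e G′ e∈ cyc with removals-glue⁻ Fs _ e∈
    ... | inj₂ (B′ , b∈ , refl) with removals-map⁻ (bridge _) Cs b∈
    ... | c , Cs′ , c∈ , refl , refl with bridge-ends {suc m} c
    ... | e₁ , e₂ = ab c Cs′ c∈ _ _ (inj₁ (e₁ , e₂)) (Glue.Conn⇒PortConn Fs Cs′ nonLoop (subst₂ (Conn _) e₁ e₂ cyc))
    Acyclic-glue acs ab e G′ e∈ cyc | inj₁ (y , e₀ , F′ , e₀∈ , refl , refl) = copyCycle
      where
      open WithoutEdge y e₀ F′ e₀∈
      module G′ = Glue Fs′ Cs nonLoop′
      toF′ : ∀ {a b} → Conn (Fs′ y) a b → Conn F′ a b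
      toF′ = subst (λ L → Conn L _ _) Fs′-y
      cyc′ : Conn G′.G (end₁ e₀ ∷ʳ y) (end₂ e₀ ∷ʳ y)
      cyc′ = subst (Conn _ _) (end₂-copy y (nonLoop y (removals-∈ e₀∈))) cyc
      copyCycle : ⊥
      copyCycle with G′.Conn-glue⁻ cyc′ refl refl
      ... | inj₁ (_ , c) = acs y e₀ F′ e₀∈ (toF′ c)
      ... | inj₂ (j , j′ , c₁ , pc , c₂)
            with last-exit Side Side? pc (refl , Conn-sym (toF′ c₁)) (λ s → acs y e₀ F′ e₀∈ (Conn-sym (proj₂ s) ◅◅ toF′ c₂))
      ... | (_ , k) , q , (refl , cs) , inj₁ (eq , cc) , ¬q , _ = ¬q (sym eq , (Conn-sym (toF′ cc) ◅◅ cs))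
      ... | (_ , k) , q , (refl , cs) , inj₂ (c , c∈ , l) , ¬q , rest =
            ab c Cs′ c∈Cs′ (y , k) q l (Glue.PortConn-sym Fs Cs′ nonLoop back)
        where
        Cs′ = proj₁ (∈⇒removals c∈)
        c∈Cs′ = proj₂ (∈⇒removals c∈)
        avoid : ∀ {a b} → Outside G′.PortAdj Side a b → Glue.PortAdj Fs Cs′ nonLoop a b
        avoid (_ , _ , inj₁ (eq , cc)) = inj₁ (eq , Conn-mono (Fs′⊆Fs _) cc)
        avoid (¬a , ¬b , inj₂ (d , d∈ , l′)) with removals-split c∈Cs′ d∈
        ... | inj₂ d∈′ = inj₂ (d , d∈′ , l′)
        ... | inj₁ refl with Link-ends l l′
        ... | inj₁ ea = ⊥-elim (¬a (subst Side (port-injective ea) (refl , cs)))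
        ... | inj₂ eb = ⊥-elim (¬b (subst Side (port-injective eb) (refl , cs)))
        close : Glue.PortAdj Fs Cs′ nonLoop (y , j′) (y , k)
        close = inj₁ (refl , (Conn-mono (Fs′⊆Fs y) c₂ ◅◅ (Conn-sym (edge⇒Conn (removals-∈ e₀∈)) ◅◅ Conn-mono (removals-⊆ e₀∈) (Conn-sym cs))))
        back : Glue.PortConn Fs Cs′ nonLoop q (y , k)
        back = Star.map avoid rest ◅◅ (close ◅ ε)

  module GlueRooted {n} (Fs : X → List (Edge n)) (Cs : List Bridge) (nonLoop : ∀ x {e} → e ∈ Fs x → NonLoop e) where
    open Glue Fs Cs nonLoop

    corner≡port : ∀ i → const (suc n) i ≡ port (i , i)
    corner≡port = const-∷ʳ n

    Rooted-glue⁺ : (∀ x → Rooted (Fs x)) → (∀ p → Σ X λ i → PortConn p (i , i)) → Rooted G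
    Rooted-glue⁺ rooted toCorner v with initLast v
    ... | w , x , refl with rooted x w
    ... | j , c with toCorner (x , j)
    ... | i , pc = i , subst (Conn G (w ∷ʳ x)) (sym (corner≡port i)) (Conn-copy⁺ x c ◅◅ PortConn⇒Conn pc)

    Rooted-glue⁻ : Rooted G → ∀ p → Σ X λ i → PortConn p (i , i)
    Rooted-glue⁻ rooted p with rooted (port p)
    ... | i , c = i , Conn⇒PortConn (subst (Conn G (port p)) (corner≡port i) c)

    Unrooted-copy : ∀ x → Unrooted (Fs x) → Unrooted G
    Unrooted-copy x (w , unrooted) = w ∷ʳ x , λ i c → escape (Conn-glue⁻ c refl (corner≡port i))
      where
      escape : ∀ {i} → Route w x (const n i) i → ⊥
      escape (inj₁ (refl , c′)) = unrooted _ c′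
      escape (inj₂ (j , _ , c₁ , _ , _)) = unrooted j c₁

    corners⇒PortConn : ∀ i j → Conn G (const (suc n) i) (const (suc n) j) → PortConn (i , i) (j , j)
    corners⇒PortConn i j c = Conn⇒PortConn (subst₂ (Conn G) (corner≡port i) (corner≡port j) c)

    PortConn⇒corners : ∀ i j → PortConn (i , i) (j , j) → Conn G (const (suc n) i) (const (suc n) j)
    PortConn⇒corners i j pc = subst₂ (Conn G) (sym (corner≡port i)) (sym (corner≡port j)) (PortConn⇒Conn pc)

module PortComposition where

  open import Data.Bool using (Bool; true; _∧_; _∨_; not; if_then_else_)
  open import Data.Bool.ListAction using (all)
  open import Data.Fin using (Fin; zero; suc)
  import Data.Fin as Fin
  open import Data.List using (List; []; _∷_; map)
  open import Data.List.Membership.Propositional using (_∈_)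
  open import Data.List.Relation.Unary.Any using (here; there)
  open import Data.Maybe using (Maybe; just; nothing)
  open import Data.Nat using (zero; suc)
  open import Data.Product using (_×_; _,_; Σ; proj₁; proj₂)
  open import Data.Sum using (_⊎_; inj₁; inj₂)
  open import Data.Vec using (_∷_; []; lookup)
  open import Relation.Nullary using (does)
  open import Relation.Nullary.Decidable using (dec-true)
  open import Relation.Binary.PropositionalEquality
  open import Data.Bool.Properties using (⇔→≡; ¬-not)
  open import Function using (_$_)
  open import Function.Bundles using (mk⇔)
  open import Relation.Binary.Construct.Closure.ReflexiveTransitive using (Star; ε; _◅_; _◅◅_)
  import Relation.Binary.Construct.Closure.ReflexiveTransitive as Star

  open import Defs
  open ListLemmas
  open Words
  open SchreierGraph
  open Connectivity
  open ForestTypes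
  open Gluing

  Joins : Port × Port → Port → Port → Set
  Joins (a , b) u v = (u ≡ a × v ≡ b) ⊎ (u ≡ b × v ≡ a)

  corner : X → Port
  corner i = i , i

  ports : List Port
  ports = (x0 , x0) ∷ (x0 , x1) ∷ (x0 , x2) ∷ (x1 , x0) ∷ (x1 , x1) ∷ (x1 , x2) ∷ (x2 , x0) ∷ (x2 , x1) ∷ (x2 , x2) ∷ []

  ∈ports : ∀ p → p ∈ ports
  ∈ports (zero , zero) = here refl
  ∈ports (zero , suc zero) = there (here refl)
  ∈ports (zero , suc (suc zero)) = there (there (here refl))
  ∈ports (suc zero , zero) = there (there (there (here refl)))
  ∈ports (suc zero , suc zero) = there (there (there (there (here refl))))
  ∈ports (suc zero , suc (suc zero)) = there (there (there (there (there (here refl)))))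
  ∈ports (suc (suc zero) , zero) = there (there (there (there (there (there (here refl))))))
  ∈ports (suc (suc zero) , suc zero) = there (there (there (there (there (there (there (here refl)))))))
  ∈ports (suc (suc zero) , suc (suc zero)) = there (there (there (there (there (there (there (there (here refl))))))))

  -- Once the copies are known to be forests of types πs, connectivity in the glued graph is read off a graph on
  -- the nine ports: ports of one copy are joined when that copy's partition puts them in one block, and each
  -- chosen bridge joins its two ports.
  module PortGraph (πs : X → Partition) where

    SameBlock : Port → Port → Set
    SameBlock u v = proj₁ u ≡ proj₁ v × sameBlock (πs (proj₁ u)) (proj₂ u) (proj₂ v) ≡ true

    PortStep : List Bridge → Port → Port → Set
    PortStep [] = SameBlock
    PortStep (c ∷ Cs) u v = PortStep Cs u v ⊎ Joins (bridgePorts c) u v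

    PortStep-sym : ∀ Cs {u v} → PortStep Cs u v → PortStep Cs v u
    PortStep-sym [] {x , j} {.x , k} (refl , s) = refl , trans (sameBlock-sym (πs x) k j) s
    PortStep-sym (c ∷ Cs) (inj₁ s) = inj₁ (PortStep-sym Cs s)
    PortStep-sym (c ∷ Cs) (inj₂ (inj₁ (a , b))) = inj₂ (inj₂ (b , a))
    PortStep-sym (c ∷ Cs) (inj₂ (inj₂ (a , b))) = inj₂ (inj₁ (b , a))

    sameBlockᵇ : Port → Port → Bool
    sameBlockᵇ (x , j) (y , k) = does (x Fin.≟ y) ∧ sameBlock (πs x) j k

    addBridge : (Port → Port → Bool) → Port × Port → Port → Port → Bool
    addBridge M (a , b) u v = M u v ∨ (M u a ∧ M b v) ∨ (M u b ∧ M a v)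

    portMatrix : List Bridge → Port → Port → Bool
    portMatrix [] = sameBlockᵇ
    portMatrix (c ∷ Cs) = addBridge (portMatrix Cs) (bridgePorts c)

    sameBlockᵇ-sound : ∀ u v → sameBlockᵇ u v ≡ true → Star SameBlock u v
    sameBlockᵇ-sound (x , j) (y , k) t with ∧-true⁻ {does (x Fin.≟ y)} t
    ... | x≟y , s with dec-true⁻ (x Fin.≟ y) x≟y
    ... | refl = (refl , s) ◅ ε

    sameBlockᵇ-complete : ∀ {u v} → Star SameBlock u v → sameBlockᵇ u v ≡ true
    sameBlockᵇ-complete {x , j} ε = ∧-true⁺ (dec-true (x Fin.≟ x) refl) (sameBlock-refl (πs x) j)
    sameBlockᵇ-complete {x , j} ((refl , s) ◅ p) with sameBlockᵇ-complete p
    ... | t with ∧-true⁻ t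
    ... | x≟y , s′ = ∧-true⁺ x≟y (sameBlock-trans (πs x) j _ _ s s′)

    -- A path using the new bridge {a , b} can be shortcut to one that uses it at most once.
    Via : (Port → Port → Set) → Port × Port → Port → Port → Set
    Via S (a , b) u v = S u v ⊎ (S u a × S b v) ⊎ (S u b × S a v)

    portMatrix-sound : ∀ Cs u v → portMatrix Cs u v ≡ true → Star (PortStep Cs) u v
    portMatrix-sound [] u v t = sameBlockᵇ-sound u v t
    portMatrix-sound (c ∷ Cs) u v t with ∨-true⁻ {portMatrix Cs u v} t
    ... | inj₁ t₁ = Star.map inj₁ (portMatrix-sound Cs u v t₁)
    ... | inj₂ t₂ with ∨-true⁻ {portMatrix Cs u (proj₁ (bridgePorts c)) ∧ portMatrix Cs (proj₂ (bridgePorts c)) v} t₂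
    ... | inj₁ t₃ with ∧-true⁻ {portMatrix Cs u (proj₁ (bridgePorts c))} t₃
    ... | f₁ , f₂ = Star.map inj₁ (portMatrix-sound Cs _ _ f₁) ◅◅ (inj₂ (inj₁ (refl , refl)) ◅ Star.map inj₁ (portMatrix-sound Cs _ _ f₂))
    portMatrix-sound (c ∷ Cs) u v t | inj₂ t₂ | inj₂ t₃ with ∧-true⁻ {portMatrix Cs u (proj₂ (bridgePorts c))} t₃
    ... | f₁ , f₂ = Star.map inj₁ (portMatrix-sound Cs _ _ f₁) ◅◅ (inj₂ (inj₂ (refl , refl)) ◅ Star.map inj₁ (portMatrix-sound Cs _ _ f₂))

    portMatrix-complete : ∀ Cs {u v} → Star (PortStep Cs) u v → portMatrix Cs u v ≡ true
    portMatrix-complete [] p = sameBlockᵇ-complete p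
    portMatrix-complete (c ∷ Cs) {u} {v} p = toBool (shortcut p)
      where
      a = proj₁ (bridgePorts c)
      b = proj₂ (bridgePorts c)
      S = Star (PortStep Cs)
      shortcut : ∀ {u v} → Star (PortStep (c ∷ Cs)) u v → Via S (a , b) u v
      shortcut ε = inj₁ ε
      shortcut (inj₁ s ◅ p) with shortcut p
      ... | inj₁ q = inj₁ (s ◅ q)
      ... | inj₂ (inj₁ (q₁ , q₂)) = inj₂ (inj₁ (s ◅ q₁ , q₂))
      ... | inj₂ (inj₂ (q₁ , q₂)) = inj₂ (inj₂ (s ◅ q₁ , q₂))
      shortcut (inj₂ (inj₁ (refl , refl)) ◅ p) with shortcut p
      ... | inj₁ q = inj₂ (inj₁ (ε , q))
      ... | inj₂ (inj₁ (_ , q₂)) = inj₂ (inj₁ (ε , q₂))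
      ... | inj₂ (inj₂ (_ , q₂)) = inj₁ q₂
      shortcut (inj₂ (inj₂ (refl , refl)) ◅ p) with shortcut p
      ... | inj₁ q = inj₂ (inj₂ (ε , q))
      ... | inj₂ (inj₁ (_ , q₂)) = inj₁ q₂
      ... | inj₂ (inj₂ (_ , q₂)) = inj₂ (inj₂ (ε , q₂))
      toBool : Via S (a , b) u v → addBridge (portMatrix Cs) (a , b) u v ≡ true
      toBool (inj₁ q) = ∨-trueˡ _ (portMatrix-complete Cs q)
      toBool (inj₂ (inj₁ (q₁ , q₂))) =
        ∨-trueʳ (portMatrix Cs u v) (∨-trueˡ _ (∧-true⁺ (portMatrix-complete Cs q₁) (portMatrix-complete Cs q₂)))
      toBool (inj₂ (inj₂ (q₁ , q₂))) =
        ∨-trueʳ (portMatrix Cs u v) (∨-trueʳ (portMatrix Cs u a ∧ portMatrix Cs b v) (∧-true⁺ (portMatrix-complete Cs q₁) (portMatrix-complete Cs q₂)))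

    portsAcyclic : List Bridge → Bool
    portsAcyclic Cs = all (λ { (c , Cs′) → not (portMatrix Cs′ (proj₁ (bridgePorts c)) (proj₂ (bridgePorts c))) }) (removals Cs)

    reachesCorner : List Bridge → Port → Bool
    reachesCorner Cs p = portMatrix Cs p (corner x0) ∨ portMatrix Cs p (corner x1) ∨ portMatrix Cs p (corner x2)

    portsRooted : List Bridge → Bool
    portsRooted Cs = all (reachesCorner Cs) ports

    portType : List Bridge → Maybe Partition
    portType Cs = if portsAcyclic Cs ∧ portsRooted Cs
      then just (classify (portMatrix Cs (corner x0) (corner x1)) (portMatrix Cs (corner x0) (corner x2)) (portMatrix Cs (corner x1) (corner x2)))
      else nothing

  composeType : Maybe Partition → Maybe Partition → Maybe Partition → List Bridge → Maybe Partition
  composeType (just π₀) (just π₁) (just π₂) Cs = PortGraph.portType (lookup (π₀ ∷ π₁ ∷ π₂ ∷ [])) Cs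
  composeType _ _ _ _ = nothing

  module GlueType {m} (Fs : X → List (Edge (suc m))) (Cs : List Bridge) (nonLoop : ∀ x {e} → e ∈ Fs x → NonLoop e) where
    open Glue Fs Cs nonLoop
    open GlueAcyclic Fs Cs nonLoop
    open GlueRooted Fs Cs nonLoop

    typeOf-glue-nothing : ∀ x → typeOf (Fs x) ≡ nothing → typeOf G ≡ nothing
    typeOf-glue-nothing x t with typeOf-nothing⁻ (Fs x) t
    ... | inj₁ ¬ac = typeOf-nothing⁺ G (inj₁ λ ac → ¬ac (Acyclic⇒copyAcyclic ac x))
    ... | inj₂ unrooted = typeOf-nothing⁺ G (inj₂ (Unrooted-copy x unrooted))

    Link⇒Joins : ∀ c {u v} → Link (bridge (suc m) c) (port u) (port v) → Joins (bridgePorts c) u v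
    Link⇒Joins c (inj₁ (a , b)) =
      inj₁ (port-injective (trans (sym a) (proj₁ (bridge-ends c))) , port-injective (trans (sym b) (proj₂ (bridge-ends c))))
    Link⇒Joins c (inj₂ (a , b)) =
      inj₂ (port-injective (trans (sym b) (proj₂ (bridge-ends c))) , port-injective (trans (sym a) (proj₁ (bridge-ends c))))

    Joins⇒Link : ∀ c {u v} → Joins (bridgePorts c) u v → Link (bridge (suc m) c) (port u) (port v)
    Joins⇒Link c (inj₁ (refl , refl)) = inj₁ (bridge-ends c)
    Joins⇒Link c (inj₂ (refl , refl)) = inj₂ (bridge-ends c)

    module WithTypes (πs : X → Partition) (typed : ∀ x → IsForestOfType (Fs x) (πs x)) where
      open PortGraph πs

      PortAdj⇒PortStep : ∀ Cs′ {u v} → Glue.PortAdj Fs Cs′ nonLoop u v → PortStep Cs′ u v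
      PortAdj⇒PortStep Cs′ {x , j} {.x , k} (inj₁ (refl , c)) = sameBlockStep Cs′ (refl , Conn⇒sameBlock (typed x) j k c)
        where
        sameBlockStep : ∀ Cs′ {u v} → SameBlock u v → PortStep Cs′ u v
        sameBlockStep [] s = s
        sameBlockStep (_ ∷ Cs′) s = inj₁ (sameBlockStep Cs′ s)
      PortAdj⇒PortStep Cs′ (inj₂ (c , c∈ , l)) = viaBridge c∈ (Link⇒Joins c l)
        where
        viaBridge : ∀ {Cs′ c u v} → c ∈ Cs′ → Joins (bridgePorts c) u v → PortStep Cs′ u v
        viaBridge (here refl) j = inj₂ j
        viaBridge (there c∈) j = inj₁ (viaBridge c∈ j)

      PortStep⇒PortAdj : ∀ Cs′ {u v} → PortStep Cs′ u v → Glue.PortAdj Fs Cs′ nonLoop u v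
      PortStep⇒PortAdj [] {x , j} {.x , k} (refl , s) = inj₁ (refl , sameBlock⇒Conn (typed x) j k s)
      PortStep⇒PortAdj (c ∷ Cs′) (inj₁ s) with PortStep⇒PortAdj Cs′ s
      ... | inj₁ same = inj₁ same
      ... | inj₂ (d , d∈ , l) = inj₂ (d , there d∈ , l)
      PortStep⇒PortAdj (c ∷ Cs′) (inj₂ j) = inj₂ (c , here refl , Joins⇒Link c j)

      PortConn⇒portMatrix : ∀ Cs′ {u v} → Glue.PortConn Fs Cs′ nonLoop u v → portMatrix Cs′ u v ≡ true
      PortConn⇒portMatrix Cs′ pc = portMatrix-complete Cs′ (Star.map (PortAdj⇒PortStep Cs′) pc)

      portMatrix⇒PortConn : ∀ Cs′ {u v} → portMatrix Cs′ u v ≡ true → Glue.PortConn Fs Cs′ nonLoop u v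
      portMatrix⇒PortConn Cs′ t = Star.map (PortStep⇒PortAdj Cs′) (portMatrix-sound Cs′ _ _ t)

      BridgesAcyclic⇒portsAcyclic : BridgesAcyclic → portsAcyclic Cs ≡ true
      BridgesAcyclic⇒portsAcyclic ab = all-true⁺ _ (removals Cs) λ { {c , Cs′} c∈ → not-true⁺ (¬-not λ t →
        ab c Cs′ c∈ _ _ (Joins⇒Link c (inj₁ (refl , refl))) (portMatrix⇒PortConn Cs′ t)) }

      portsAcyclic⇒BridgesAcyclic : portsAcyclic Cs ≡ true → BridgesAcyclic
      portsAcyclic⇒BridgesAcyclic t c Cs′ c∈ p q l pc
        with not-true⁻ (all-true⁻ (λ { (c , Cs′) → not (portMatrix Cs′ (proj₁ (bridgePorts c)) (proj₂ (bridgePorts c))) }) t c∈)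
           | Link⇒Joins c l
      ... | f | inj₁ (refl , refl) = true≢false (trans (sym (PortConn⇒portMatrix Cs′ pc)) f)
      ... | f | inj₂ (refl , refl) = true≢false (trans (sym (PortConn⇒portMatrix Cs′ (Glue.PortConn-sym Fs Cs′ nonLoop pc))) f)

      acyclic-glue : acyclic G ≡ portsAcyclic Cs
      acyclic-glue = ⇔→≡ $ mk⇔
        (λ t → BridgesAcyclic⇒portsAcyclic (Acyclic⇒BridgesAcyclic (acyclic-sound G t)))
        (λ t → acyclic-complete G (Acyclic-glue (λ x → IsForestOfType.isAcyclic (typed x)) (portsAcyclic⇒BridgesAcyclic t)))

      portsRooted-sound : portsRooted Cs ≡ true → ∀ p → Σ X λ i → PortConn p (corner i)
      portsRooted-sound t p with ∨-true⁻ (all-true⁻ (reachesCorner Cs) t (∈ports p))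
      ... | inj₁ r = x0 , portMatrix⇒PortConn Cs r
      ... | inj₂ r′ with ∨-true⁻ r′
      ... | inj₁ r = x1 , portMatrix⇒PortConn Cs r
      ... | inj₂ r = x2 , portMatrix⇒PortConn Cs r

      portsRooted-complete : (∀ p → Σ X λ i → PortConn p (corner i)) → portsRooted Cs ≡ true
      portsRooted-complete h = all-true⁺ _ ports λ {p} _ → toCorner p (h p)
        where
        toCorner : ∀ p → Σ X (λ i → PortConn p (corner i)) → reachesCorner Cs p ≡ true
        toCorner p (zero , pc) = ∨-trueˡ _ (PortConn⇒portMatrix Cs pc)
        toCorner p (suc zero , pc) = ∨-trueʳ (portMatrix Cs p (corner x0)) (∨-trueˡ _ (PortConn⇒portMatrix Cs pc))
        toCorner p (suc (suc zero) , pc) =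
          ∨-trueʳ (portMatrix Cs p (corner x0)) (∨-trueʳ (portMatrix Cs p (corner x1)) (PortConn⇒portMatrix Cs pc))

      cover-glue : cover G ≡ portsRooted Cs
      cover-glue = ⇔→≡ $ mk⇔
        (λ t → portsRooted-complete (Rooted-glue⁻ (cover-sound G t)))
        (λ t → Rooted⇒cover G (Rooted-glue⁺ (λ x → IsForestOfType.isRooted (typed x)) (portsRooted-sound t)))

      connMatrix-glue : ∀ i j → connMatrix G i j ≡ portMatrix Cs (corner i) (corner j)
      connMatrix-glue i j = ⇔→≡ $ mk⇔
        (λ t → PortConn⇒portMatrix Cs (corners⇒PortConn i j (conn-sound G _ _ t)))
        (λ t → conn-complete G _ _ (PortConn⇒corners i j (portMatrix⇒PortConn Cs t)))

      typeOf-glue-typed : typeOf G ≡ portType Cs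
      typeOf-glue-typed rewrite acyclic-glue | cover-glue | connMatrix-glue x0 x1 | connMatrix-glue x0 x2 | connMatrix-glue x1 x2 = refl

  typeOf-glue : ∀ {m} (Fs : X → List (Edge (suc m))) Cs (nonLoop : ∀ x {e} → e ∈ Fs x → NonLoop e) →
    typeOf (glue Fs (map (bridge (suc m)) Cs)) ≡ composeType (typeOf (Fs x0)) (typeOf (Fs x1)) (typeOf (Fs x2)) Cs
  typeOf-glue Fs Cs nonLoop with typeOf (Fs x0) in t₀ | typeOf (Fs x1) in t₁ | typeOf (Fs x2) in t₂
  ... | just π₀ | just π₁ | just π₂ = WithTypes.typeOf-glue-typed (lookup (π₀ ∷ π₁ ∷ π₂ ∷ [])) typed
    where
    open GlueType Fs Cs nonLoop
    typed : ∀ x → IsForestOfType (Fs x) (lookup (π₀ ∷ π₁ ∷ π₂ ∷ []) x)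
    typed zero = typeOf-just⁻ (Fs x0) t₀
    typed (suc zero) = typeOf-just⁻ (Fs x1) t₁
    typed (suc (suc zero)) = typeOf-just⁻ (Fs x2) t₂
  ... | nothing | _ | _ = GlueType.typeOf-glue-nothing Fs Cs nonLoop x0 t₀
  ... | just _ | nothing | _ = GlueType.typeOf-glue-nothing Fs Cs nonLoop x1 t₁
  ... | just _ | just _ | nothing = GlueType.typeOf-glue-nothing Fs Cs nonLoop x2 t₂

module FiniteSums where

  open import Algebra.Bundles using (CommutativeSemiring)
  open import Data.Bool using (Bool; true; false; if_then_else_)
  open import Data.List using (List; []; _∷_; _++_; map; foldr)
  open import Data.List.Properties using (map-++; map-∘)
  open import Data.List.Membership.Propositional using (_∈_)
  open import Data.List.Relation.Unary.Any using (here; there)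
  open import Data.List.Relation.Unary.All using ([]; _∷_; lookup)
  open import Data.List.Relation.Unary.AllPairs using ([]; _∷_)
  open import Data.List.Relation.Unary.Unique.Propositional using (Unique)
  open import Data.List.Relation.Binary.Permutation.Propositional using (_↭_)
  import Data.List.Relation.Binary.Permutation.Propositional as Perm
  open import Relation.Nullary using (Dec; yes; no; does)
  open import Relation.Nullary.Negation using (contradiction)
  import Relation.Binary.PropositionalEquality as ≡
  open ≡ using (_≡_)

  open import Defs using (sublists)

  module RawSums {a} {A : Set a} (_⊕_ : A → A → A) (𝟘 : A) where

    when : Bool → A → A
    when b x = if b then x else 𝟘

    sumOver : ∀ {B : Set} → (B → A) → List B → A
    sumOver f = foldr (λ x acc → f x ⊕ acc) 𝟘

  sublists-map : ∀ {B C : Set} (f : B → C) (L : List B) → sublists (map f L) ≡ map (map f) (sublists L)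
  sublists-map f [] = ≡.refl
  sublists-map f (x ∷ L) = ≡.trans (≡.cong (λ S → map (f x ∷_) S ++ S) (sublists-map f L))
    (≡.sym (≡.trans (map-++ (map f) (map (x ∷_) (sublists L)) (sublists L))
       (≡.cong (_++ map (map f) (sublists L)) (≡.trans (≡.sym (map-∘ (sublists L))) (map-∘ (sublists L))))))

  module SemiringSums {r ℓ} (Rg : CommutativeSemiring r ℓ) where
    open CommutativeSemiring Rg
    open import Relation.Binary.Reasoning.Setoid setoid
    open RawSums _+_ 0# public

    ≡⇒≈ : ∀ {x y} → x ≡ y → x ≈ y
    ≡⇒≈ ≡.refl = refl

    when-cong : ∀ b {x y} → x ≈ y → when b x ≈ when b y
    when-cong true p = p
    when-cong false p = refl

    when-*ˡ : ∀ b (x y : Carrier) → when b (x * y) ≈ x * when b y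
    when-*ˡ true x y = refl
    when-*ˡ false x y = sym (zeroʳ x)

    sumOver-cong : ∀ {B : Set} {f g : B → Carrier} (L : List B) → (∀ {x} → x ∈ L → f x ≈ g x) → sumOver f L ≈ sumOver g L
    sumOver-cong [] h = refl
    sumOver-cong (x ∷ L) h = +-cong (h (here ≡.refl)) (sumOver-cong L (h ∘ there))
      where open import Function using (_∘_)

    sumOver-++ : ∀ {B : Set} (f : B → Carrier) (L M : List B) → sumOver f (L ++ M) ≈ sumOver f L + sumOver f M
    sumOver-++ f [] M = sym (+-identityˡ _)
    sumOver-++ f (x ∷ L) M = trans (+-cong refl (sumOver-++ f L M)) (sym (+-assoc _ _ _))

    sumOver-map : ∀ {B C : Set} (f : C → Carrier) (h : B → C) (L : List B) → sumOver f (map h L) ≡ sumOver (λ x → f (h x)) L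
    sumOver-map f h [] = ≡.refl
    sumOver-map f h (x ∷ L) = ≡.cong (f (h x) +_) (sumOver-map f h L)

    sumOver-*ˡ : ∀ {B : Set} (c : Carrier) (f : B → Carrier) (L : List B) → sumOver (λ x → c * f x) L ≈ c * sumOver f L
    sumOver-*ˡ c f [] = sym (zeroʳ c)
    sumOver-*ˡ c f (x ∷ L) = trans (+-cong refl (sumOver-*ˡ c f L)) (sym (distribˡ c _ _))

    sumOver-+ : ∀ {B : Set} (f g : B → Carrier) (L : List B) → sumOver (λ x → f x + g x) L ≈ sumOver f L + sumOver g L
    sumOver-+ f g [] = sym (+-identityˡ 0#)
    sumOver-+ f g (x ∷ L) = begin
      (f x + g x) + sumOver (λ x → f x + g x) L ≈⟨ +-cong refl (sumOver-+ f g L) ⟩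
      (f x + g x) + (sumOver f L + sumOver g L) ≈⟨ +-assoc _ _ _ ⟩
      f x + (g x + (sumOver f L + sumOver g L)) ≈⟨ +-cong refl (sym (+-assoc _ _ _)) ⟩
      f x + ((g x + sumOver f L) + sumOver g L) ≈⟨ +-cong refl (+-cong (+-comm _ _) refl) ⟩
      f x + ((sumOver f L + g x) + sumOver g L) ≈⟨ +-cong refl (+-assoc _ _ _) ⟩
      f x + (sumOver f L + (g x + sumOver g L)) ≈⟨ sym (+-assoc _ _ _) ⟩
      (f x + sumOver f L) + (g x + sumOver g L) ∎

    sumOver-zero : ∀ {B : Set} (f : B → Carrier) (L : List B) → (∀ {x} → x ∈ L → f x ≈ 0#) → sumOver f L ≈ 0#
    sumOver-zero f [] h = refl
    sumOver-zero f (x ∷ L) h = trans (+-cong (h (here ≡.refl)) (sumOver-zero f L (λ m → h (there m)))) (+-identityˡ 0#)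

    sumOver-single : ∀ {B : Set} (_≟_ : (s t : B) → Dec (s ≡ t)) (f : B → Carrier) {s} (L : List B) →
      Unique L → s ∈ L → sumOver (λ t → when (does (s ≟ t)) (f t)) L ≈ f s
    sumOver-single _≟_ f {s} (t ∷ L) (t∉L ∷ u) s∈ with s ≟ t | s∈
    ... | yes ≡.refl | _ = trans (+-cong refl (sumOver-zero _ L absent)) (+-identityʳ _)
      where
      absent : ∀ {x} → x ∈ L → when (does (s ≟ x)) (f x) ≈ 0#
      absent {x} x∈ with s ≟ x
      ... | yes ≡.refl = contradiction ≡.refl (lookup t∉L x∈)
      ... | no _ = refl
    ... | no s≢t | here s≡t = contradiction s≡t s≢t
    ... | no _ | there s∈L = trans (+-identityˡ _) (sumOver-single _≟_ f L u s∈L)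

    subsetSum : ∀ {B : Set} → (List B → Carrier) → List B → Carrier
    subsetSum g E = sumOver g (sublists E)

    subsetSum-∷ : ∀ {B : Set} (g : List B → Carrier) x E → subsetSum g (x ∷ E) ≈ subsetSum (λ F → g (x ∷ F)) E + subsetSum g E
    subsetSum-∷ g x E = trans (sumOver-++ g (map (x ∷_) (sublists E)) (sublists E))
                              (+-cong (≡⇒≈ (sumOver-map g (x ∷_) (sublists E))) refl)

    subsetSum-↭ : ∀ {B : Set} {E E′ : List B} → E ↭ E′ → (g : List B → Carrier) → (∀ {F F′} → F ↭ F′ → g F ≈ g F′) →
      subsetSum g E ≈ subsetSum g E′
    subsetSum-↭ Perm.refl g h = refl
    subsetSum-↭ {E = x ∷ E} {x ∷ E′} (Perm.prep x p) g h =
      trans (subsetSum-∷ g x E)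
            (trans (+-cong (subsetSum-↭ p (λ F → g (x ∷ F)) (h ∘ Perm.prep x)) (subsetSum-↭ p g h)) (sym (subsetSum-∷ g x E′)))
      where open import Function using (_∘_)
    subsetSum-↭ {E = x ∷ y ∷ E} {y ∷ x ∷ E′} (Perm.swap x y p) g h = begin
      subsetSum g (x ∷ y ∷ E)
        ≈⟨ trans (subsetSum-∷ g x (y ∷ E)) (+-cong (subsetSum-∷ (λ F → g (x ∷ F)) y E) (subsetSum-∷ g y E)) ⟩
      (subsetSum (λ F → g (x ∷ y ∷ F)) E + subsetSum (λ F → g (x ∷ F)) E) + (subsetSum (λ F → g (y ∷ F)) E + subsetSum g E)
        ≈⟨ +-cong (+-cong (trans (subsetSum-↭ p (λ F → g (x ∷ y ∷ F)) (λ q → h (Perm.prep x (Perm.prep y q))))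
                                 (sumOver-cong (sublists E′) (λ _ → h (Perm.swap x y Perm.refl))))
                          (subsetSum-↭ p _ (λ q → h (Perm.prep x q))))
                  (+-cong (subsetSum-↭ p _ (λ q → h (Perm.prep y q))) (subsetSum-↭ p g h)) ⟩
      (subsetSum (λ F → g (y ∷ x ∷ F)) E′ + subsetSum (λ F → g (x ∷ F)) E′) + (subsetSum (λ F → g (y ∷ F)) E′ + subsetSum g E′)
        ≈⟨ middle-swap _ _ _ _ ⟩
      (subsetSum (λ F → g (y ∷ x ∷ F)) E′ + subsetSum (λ F → g (y ∷ F)) E′) + (subsetSum (λ F → g (x ∷ F)) E′ + subsetSum g E′)
        ≈⟨ sym (trans (subsetSum-∷ g y (x ∷ E′)) (+-cong (subsetSum-∷ (λ F → g (y ∷ F)) x E′) (subsetSum-∷ g x E′))) ⟩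
      subsetSum g (y ∷ x ∷ E′) ∎
      where
      middle-swap : ∀ p q r s → (p + q) + (r + s) ≈ (p + r) + (q + s)
      middle-swap p q r s = begin
        (p + q) + (r + s) ≈⟨ +-assoc p q (r + s) ⟩
        p + (q + (r + s)) ≈⟨ +-cong refl (sym (+-assoc q r s)) ⟩
        p + ((q + r) + s) ≈⟨ +-cong refl (+-cong (+-comm q r) refl) ⟩
        p + ((r + q) + s) ≈⟨ +-cong refl (+-assoc r q s) ⟩
        p + (r + (q + s)) ≈⟨ sym (+-assoc p r (q + s)) ⟩
        (p + r) + (q + s) ∎
    subsetSum-↭ (Perm.trans p q) g h = trans (subsetSum-↭ p g h) (subsetSum-↭ q g h)

    subsetSum-++ : ∀ {B : Set} (g : List B → Carrier) (E E′ : List B) →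
      subsetSum g (E ++ E′) ≈ subsetSum (λ F → subsetSum (λ F′ → g (F ++ F′)) E′) E
    subsetSum-++ g [] E′ = sym (+-identityʳ _)
    subsetSum-++ g (x ∷ E) E′ = begin
      subsetSum g (x ∷ (E ++ E′)) ≈⟨ subsetSum-∷ g x (E ++ E′) ⟩
      subsetSum (λ F → g (x ∷ F)) (E ++ E′) + subsetSum g (E ++ E′) ≈⟨ +-cong (subsetSum-++ (λ F → g (x ∷ F)) E E′) (subsetSum-++ g E E′) ⟩
      subsetSum (λ F → subsetSum (λ F′ → g (x ∷ (F ++ F′))) E′) E + subsetSum (λ F → subsetSum (λ F′ → g (F ++ F′)) E′) E
        ≈⟨ sym (subsetSum-∷ (λ F → subsetSum (λ F′ → g (F ++ F′)) E′) x E) ⟩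
      subsetSum (λ F → subsetSum (λ F′ → g (F ++ F′)) E′) (x ∷ E) ∎

    subsetSum-map : ∀ {B C : Set} (g : List C → Carrier) (f : B → C) (E : List B) → subsetSum g (map f E) ≡ subsetSum (λ F → g (map f F)) E
    subsetSum-map g f E = ≡.trans (≡.cong (sumOver g) (sublists-map f E)) (sumOver-map g (map f) (sublists E))

    subsetSum-map-++ : ∀ {B C : Set} (g : List C → Carrier) (f : B → C) (E : List B) (E′ : List C) →
      subsetSum g (map f E ++ E′) ≈ subsetSum (λ F → subsetSum (λ F′ → g (map f F ++ F′)) E′) E
    subsetSum-map-++ g f E E′ = trans (subsetSum-++ g (map f E) E′) (≡⇒≈ (subsetSum-map (λ F → subsetSum (λ F′ → g (F ++ F′)) E′) f E))

module Recurrence where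

  open import Algebra.Bundles using (CommutativeSemiring)
  open import Data.Bool using (Bool)
  open import Data.Fin using (zero; suc)
  open import Data.List using (List; []; _∷_; _++_; map; foldr)
  open import Data.List.Membership.Propositional using (_∈_)
  open import Data.List.Relation.Unary.Any using (here; there)
  open import Data.List.Relation.Unary.All using ([]; _∷_)
  open import Data.List.Relation.Unary.AllPairs using ([]; _∷_)
  open import Data.List.Relation.Unary.Unique.Propositional using (Unique)
  open import Data.List.Relation.Binary.Permutation.Propositional using (_↭_)
  import Data.List.Relation.Binary.Permutation.Propositional as Perm
  open import Data.List.Membership.Propositional.Properties using (∈-map⁻; ∈-++⁻)
  open import Data.Maybe using (Maybe; just; nothing)
  open import Data.Nat using (ℕ; zero; suc)
  open import Data.Product using (_,_; proj₁)
  open import Data.Sum using (inj₁; inj₂)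
  open import Data.Vec using (_∷_; []; lookup)
  open import Relation.Nullary using (does)
  import Relation.Binary.PropositionalEquality as ≡
  open ≡ using (_≡_)

  open import Defs
  open SchreierGraph
  open ForestTypes
  open PortComposition
  open FiniteSums

  types : List (Maybe Partition)
  types = nothing ∷ just πT ∷ just πU ∷ just πR ∷ just πL ∷ just πQ ∷ []

  ∈types : ∀ t → t ∈ types
  ∈types nothing = here ≡.refl
  ∈types (just πT) = there (here ≡.refl)
  ∈types (just πU) = there (there (here ≡.refl))
  ∈types (just πR) = there (there (there (here ≡.refl)))
  ∈types (just πL) = there (there (there (there (here ≡.refl))))
  ∈types (just πQ) = there (there (there (there (there (here ≡.refl)))))

  types-unique : Unique types
  types-unique = ((λ ()) ∷ (λ ()) ∷ (λ ()) ∷ (λ ()) ∷ (λ ()) ∷ []) ∷ ((λ ()) ∷ (λ ()) ∷ (λ ()) ∷ (λ ()) ∷ [])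
    ∷ ((λ ()) ∷ (λ ()) ∷ (λ ()) ∷ []) ∷ ((λ ()) ∷ (λ ()) ∷ []) ∷ ((λ ()) ∷ []) ∷ [] ∷ []

  sublists-⊆ : ∀ {A : Set} {L F : List A} {e} → F ∈ sublists L → e ∈ F → e ∈ L
  sublists-⊆ {L = []} (here ≡.refl) ()
  sublists-⊆ {L = x ∷ L} m e∈ with ∈-++⁻ (map (x ∷_) (sublists L)) m
  ... | inj₂ m′ = there (sublists-⊆ m′ e∈)
  ... | inj₁ m′ with ∈-map⁻ (x ∷_) m′ | e∈
  ... | _ , m″ , ≡.refl | here ≡.refl = here ≡.refl
  ... | _ , m″ , ≡.refl | there e∈′ = there (sublists-⊆ m″ e∈′)

  -- Written over an arbitrary signature so that the same expression can be read both in the semiring and as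
  -- a polynomial handed to the ring solver.
  module BridgeSums {a} {A : Set a} (_⊕_ _⊗_ : A → A → A) (𝟘 𝟙 : A) (w : Gen → A) where
    open RawSums _⊕_ 𝟘

    bridgeWeight : List Bridge → A
    bridgeWeight = foldr (λ c acc → w (bridgeGen c) ⊗ acc) 𝟙

    bridgeSum : Partition → Maybe Partition → Maybe Partition → Maybe Partition → A
    bridgeSum π t₀ t₁ t₂ = sumOver (λ Cs → when (isType π (composeType t₀ t₁ t₂ Cs)) (bridgeWeight Cs)) (sublists bridges)

    composeSum : Partition → (Maybe Partition → A) → A
    composeSum π G = sumOver (λ t₀ → sumOver (λ t₁ → sumOver (λ t₂ → bridgeSum π t₀ t₁ t₂ ⊗ G t₂) types ⊗ G t₁) types ⊗ G t₀) types


  module Decomposition {r ℓ} (Rg : CommutativeSemiring r ℓ) (a b c : CommutativeSemiring.Carrier Rg) where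
    open CommutativeSemiring Rg hiding (zero)
    open GF Rg a b c
    open SemiringSums Rg
    open BridgeSums _+_ _*_ 0# 1# wGen
    open import Relation.Binary.Reasoning.Setoid setoid

    weight-++ : ∀ {k} (F F′ : List (Edge k)) → weight (F ++ F′) ≈ weight F * weight F′
    weight-++ [] F′ = sym (*-identityˡ _)
    weight-++ (x ∷ F) F′ = trans (*-cong refl (weight-++ F F′)) (sym (*-assoc _ _ _))

    weight-copy : ∀ {k} y (F : List (Edge k)) → weight (map (copy y) F) ≡ weight F
    weight-copy y [] = ≡.refl
    weight-copy y (x ∷ F) = ≡.cong (wGen (proj₁ x) *_) (weight-copy y F)

    weight-bridges : ∀ k Cs → weight (map (bridge k) Cs) ≡ bridgeWeight Cs
    weight-bridges k [] = ≡.refl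
    weight-bridges k (c ∷ Cs) = ≡.cong (wGen (bridgeGen c) *_) (weight-bridges k Cs)

    weight-↭ : ∀ {k} {F F′ : List (Edge k)} → F ↭ F′ → weight F ≈ weight F′
    weight-↭ Perm.refl = refl
    weight-↭ (Perm.prep x p) = *-cong refl (weight-↭ p)
    weight-↭ (Perm.swap x y p) = begin
      wGen (proj₁ x) * (wGen (proj₁ y) * _) ≈⟨ sym (*-assoc _ _ _) ⟩
      (wGen (proj₁ x) * wGen (proj₁ y)) * _ ≈⟨ *-cong (*-comm _ _) (weight-↭ p) ⟩
      (wGen (proj₁ y) * wGen (proj₁ x)) * _ ≈⟨ *-assoc _ _ _ ⟩
      wGen (proj₁ y) * (wGen (proj₁ x) * _) ∎
    weight-↭ (Perm.trans p q) = trans (weight-↭ p) (weight-↭ q)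

    typeSum : ℕ → Maybe Partition → Carrier
    typeSum k t = subsetSum (λ F → when (does (typeOf F ≟ₜ t)) (weight F)) (edges k)

    typeSum-just : ∀ k π → typeSum k (just π) ≈ gsum k (forestPredicate π)
    typeSum-just k π = sumOver-cong (sublists (edges k)) λ {F} _ →
      ≡⇒≈ (≡.cong (λ β → when β (weight F)) (≡.sym (forestPredicate-type F π)))

    sumOver-byType : ∀ {B : Set} (τ : B → Maybe Partition) (w : B → Carrier) (H : Maybe Partition → Carrier) (L : List B) →
      sumOver (λ F → w F * H (τ F)) L ≈ sumOver (λ t → H t * sumOver (λ F → when (does (τ F ≟ₜ t)) (w F)) L) types
    sumOver-byType τ w H [] = sym (sumOver-zero (λ t → H t * 0#) types λ {t} _ → zeroʳ (H t))
    sumOver-byType τ w H (x ∷ L) = begin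
      w x * H (τ x) + sumOver (λ F → w F * H (τ F)) L
        ≈⟨ +-cong (sym single) (sumOver-byType τ w H L) ⟩
      sumOver (λ t → H t * when (does (τ x ≟ₜ t)) (w x)) types + sumOver (λ t → H t * rest t) types
        ≈⟨ sym (sumOver-+ (λ t → H t * when (does (τ x ≟ₜ t)) (w x)) (λ t → H t * rest t) types) ⟩
      sumOver (λ t → H t * when (does (τ x ≟ₜ t)) (w x) + H t * rest t) types
        ≈⟨ sumOver-cong types (λ {t} _ → sym (distribˡ (H t) (when (does (τ x ≟ₜ t)) (w x)) (rest t))) ⟩
      sumOver (λ t → H t * (when (does (τ x ≟ₜ t)) (w x) + rest t)) types ∎
      where
      rest : Maybe Partition → Carrier
      rest t = sumOver (λ F → when (does (τ F ≟ₜ t)) (w F)) L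
      single : sumOver (λ t → H t * when (does (τ x ≟ₜ t)) (w x)) types ≈ w x * H (τ x)
      single = begin
        sumOver (λ t → H t * when (does (τ x ≟ₜ t)) (w x)) types
          ≈⟨ sumOver-cong types (λ {t} _ → sym (when-*ˡ (does (τ x ≟ₜ t)) (H t) (w x))) ⟩
        sumOver (λ t → when (does (τ x ≟ₜ t)) (H t * w x)) types
          ≈⟨ sumOver-single _≟ₜ_ (λ t → H t * w x) types types-unique (∈types (τ x)) ⟩
        H (τ x) * w x ≈⟨ *-comm _ _ ⟩
        w x * H (τ x) ∎

    module _ (m : ℕ) (π : Partition) where

      private
        E = edges (suc m)

      indicator : List (Edge (suc (suc m))) → Carrier
      indicator F = when (isType π (typeOf F)) (weight F)

      indicator-↭ : ∀ {F F′} → F ↭ F′ → indicator F ≈ indicator F′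
      indicator-↭ {F} p = trans (≡⇒≈ (≡.cong (λ t → when (isType π t) (weight F)) (typeOf-resp-↭ p))) (when-cong _ (weight-↭ p))

      glued : List (Edge (suc m)) → List (Edge (suc m)) → List (Edge (suc m)) → List Bridge → List (Edge (suc (suc m)))
      glued F₀ F₁ F₂ Cs = glue (lookup (F₀ ∷ F₁ ∷ F₂ ∷ [])) (map (bridge (suc m)) Cs)

      tripleSum : (List (Edge (suc m)) → List (Edge (suc m)) → List (Edge (suc m)) → Carrier) → Carrier
      tripleSum f = subsetSum (λ F₀ → subsetSum (λ F₁ → subsetSum (λ F₂ → f F₀ F₁ F₂) E) E) E

      tripleSum-cong : ∀ {f g} → (∀ {F₀ F₁ F₂} → F₀ ∈ sublists E → F₁ ∈ sublists E → F₂ ∈ sublists E → f F₀ F₁ F₂ ≈ g F₀ F₁ F₂) →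
        tripleSum f ≈ tripleSum g
      tripleSum-cong f≈g =
        sumOver-cong (sublists E) λ F₀∈ → sumOver-cong (sublists E) λ F₁∈ → sumOver-cong (sublists E) λ F₂∈ → f≈g F₀∈ F₁∈ F₂∈

      gsum-glueEdges : gsum (suc (suc m)) (forestPredicate π) ≈ subsetSum indicator (glueEdges (suc m))
      gsum-glueEdges =
        trans (sumOver-cong (sublists (edges (suc (suc m)))) λ {F} _ →
                 ≡⇒≈ (≡.cong (λ β → when β (weight F)) (forestPredicate-type F π)))
              (subsetSum-↭ (edges-suc-↭ (suc m)) indicator indicator-↭)

      glueEdges-split : subsetSum indicator (glueEdges (suc m)) ≈
        tripleSum (λ F₀ F₁ F₂ → subsetSum (λ Cs → indicator (glued F₀ F₁ F₂ Cs)) bridges)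
      glueEdges-split =
        trans (subsetSum-map-++ indicator (copy x0) E _) (sumOver-cong (sublists E) λ {F₀} _ →
        trans (subsetSum-map-++ _ (copy x1) E _) (sumOver-cong (sublists E) λ {F₁} _ →
        trans (subsetSum-map-++ _ (copy x2) E _) (sumOver-cong (sublists E) λ {F₂} _ →
        ≡⇒≈ (subsetSum-map (λ B → indicator (map (copy x0) F₀ ++ (map (copy x1) F₁ ++ (map (copy x2) F₂ ++ B))))
                            (bridge (suc m)) bridges))))

      weightedBridgeSum : List (Edge (suc m)) → List (Edge (suc m)) → List (Edge (suc m)) → Carrier
      weightedBridgeSum F₀ F₁ F₂ = weight F₀ * (weight F₁ * (weight F₂ * bridgeSum π (typeOf F₀) (typeOf F₁) (typeOf F₂)))

      bridges-glued : ∀ {F₀ F₁ F₂} → F₀ ∈ sublists E → F₁ ∈ sublists E → F₂ ∈ sublists E →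
        subsetSum (λ Cs → indicator (glued F₀ F₁ F₂ Cs)) bridges ≈ weightedBridgeSum F₀ F₁ F₂
      bridges-glued {F₀} {F₁} {F₂} F₀∈ F₁∈ F₂∈ = begin
        subsetSum (λ Cs → indicator (glued F₀ F₁ F₂ Cs)) bridges
          ≈⟨ sumOver-cong (sublists bridges) (λ {Cs} _ → pointwise Cs) ⟩
        sumOver (λ Cs → w₀ * (w₁ * (w₂ * k Cs))) (sublists bridges)
          ≈⟨ trans (sumOver-*ˡ w₀ (λ Cs → w₁ * (w₂ * k Cs)) (sublists bridges))
                   (*-cong refl (trans (sumOver-*ˡ w₁ (λ Cs → w₂ * k Cs) (sublists bridges))
                                       (*-cong refl (sumOver-*ˡ w₂ k (sublists bridges))))) ⟩
        weightedBridgeSum F₀ F₁ F₂ ∎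
        where
        w₀ = weight F₀
        w₁ = weight F₁
        w₂ = weight F₂
        β : List Bridge → Bool
        β Cs = isType π (composeType (typeOf F₀) (typeOf F₁) (typeOf F₂) Cs)
        k : List Bridge → Carrier
        k Cs = when (β Cs) (bridgeWeight Cs)
        nonLoop : ∀ x {e} → e ∈ lookup (F₀ ∷ F₁ ∷ F₂ ∷ []) x → NonLoop e
        nonLoop zero e∈ = ∈edges⇒nonLoop (sublists-⊆ F₀∈ e∈)
        nonLoop (suc zero) e∈ = ∈edges⇒nonLoop (sublists-⊆ F₁∈ e∈)
        nonLoop (suc (suc zero)) e∈ = ∈edges⇒nonLoop (sublists-⊆ F₂∈ e∈)
        weight-glued : ∀ Cs → weight (glued F₀ F₁ F₂ Cs) ≈ w₀ * (w₁ * (w₂ * bridgeWeight Cs))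
        weight-glued Cs =
          trans (weight-++ (map (copy x0) F₀) _) (*-cong (≡⇒≈ (weight-copy x0 F₀))
          (trans (weight-++ (map (copy x1) F₁) _) (*-cong (≡⇒≈ (weight-copy x1 F₁))
          (trans (weight-++ (map (copy x2) F₂) _) (*-cong (≡⇒≈ (weight-copy x2 F₂)) (≡⇒≈ (weight-bridges (suc m) Cs)))))))
        pointwise : ∀ Cs → indicator (glued F₀ F₁ F₂ Cs) ≈ w₀ * (w₁ * (w₂ * k Cs))
        pointwise Cs = begin
          when (isType π (typeOf (glued F₀ F₁ F₂ Cs))) (weight (glued F₀ F₁ F₂ Cs))
            ≈⟨ ≡⇒≈ (≡.cong (λ t → when (isType π t) (weight (glued F₀ F₁ F₂ Cs)))
                            (typeOf-glue (lookup (F₀ ∷ F₁ ∷ F₂ ∷ [])) Cs nonLoop)) ⟩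
          when (β Cs) (weight (glued F₀ F₁ F₂ Cs)) ≈⟨ when-cong (β Cs) (weight-glued Cs) ⟩
          when (β Cs) (w₀ * (w₁ * (w₂ * bridgeWeight Cs)))
            ≈⟨ trans (when-*ˡ (β Cs) w₀ _) (*-cong refl (trans (when-*ˡ (β Cs) w₁ _) (*-cong refl (when-*ˡ (β Cs) w₂ _)))) ⟩
          w₀ * (w₁ * (w₂ * k Cs)) ∎

      tripleSum-byType : tripleSum weightedBridgeSum ≈ composeSum π (typeSum (suc m))
      tripleSum-byType =
        trans (sumOver-cong (sublists E) λ {F₀} _ → trans (sumOver-cong (sublists E) λ {F₁} _ → inner F₀ F₁) (middle F₀))
              (sumOver-byType typeOf weight outer (sublists E))
        where
        G = typeSum (suc m)
        H₁ : Maybe Partition → Maybe Partition → Carrier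
        H₁ t₀ t₁ = sumOver (λ t₂ → bridgeSum π t₀ t₁ t₂ * G t₂) types
        outer : Maybe Partition → Carrier
        outer t₀ = sumOver (λ t₁ → H₁ t₀ t₁ * G t₁) types
        inner : ∀ F₀ F₁ → subsetSum (weightedBridgeSum F₀ F₁) E ≈ weight F₀ * (weight F₁ * H₁ (typeOf F₀) (typeOf F₁))
        inner F₀ F₁ = trans (sumOver-*ˡ (weight F₀) _ (sublists E)) (*-cong refl (trans (sumOver-*ˡ (weight F₁) _ (sublists E))
                       (*-cong refl (sumOver-byType typeOf weight (bridgeSum π (typeOf F₀) (typeOf F₁)) (sublists E)))))
        middle : ∀ F₀ → subsetSum (λ F₁ → weight F₀ * (weight F₁ * H₁ (typeOf F₀) (typeOf F₁))) E ≈ weight F₀ * outer (typeOf F₀)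
        middle F₀ = trans (sumOver-*ˡ (weight F₀) _ (sublists E))
                          (*-cong refl (sumOver-byType typeOf weight (H₁ (typeOf F₀)) (sublists E)))

      gsum-suc : gsum (suc (suc m)) (forestPredicate π) ≈ composeSum π (typeSum (suc m))
      gsum-suc = begin
        gsum (suc (suc m)) (forestPredicate π)                                           ≈⟨ gsum-glueEdges ⟩
        subsetSum indicator (glueEdges (suc m))                                           ≈⟨ glueEdges-split ⟩
        tripleSum (λ F₀ F₁ F₂ → subsetSum (λ Cs → indicator (glued F₀ F₁ F₂ Cs)) bridges) ≈⟨ tripleSum-cong bridges-glued ⟩
        tripleSum weightedBridgeSum                                                       ≈⟨ tripleSum-byType ⟩
        composeSum π (typeSum (suc m))                                                    ∎

  module Recurrences {r ℓ} (Rg : CommutativeSemiring r ℓ) (a b c : CommutativeSemiring.Carrier Rg) where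
    open CommutativeSemiring Rg hiding (zero)
    open GF Rg a b c
    open SemiringSums Rg
    open Decomposition Rg a b c
    open BridgeSums _+_ _*_ 0# 1# wGen
    open import Algebra.Solver.Ring.NaturalCoefficients.Default Rg public
      using (Polynomial; var; con; _:+_; _:*_; prove; ⟦_⟧)
    open import Data.Vec using (Vec)

    composeSum-cong : ∀ π {G G′ : Maybe Partition → Carrier} → (∀ t → G t ≈ G′ t) → composeSum π G ≈ composeSum π G′
    composeSum-cong π {G} {G′} G≈G′ =
      sumOver-cong {f = λ t₀ → level₀ G t₀ * G t₀} {g = λ t₀ → level₀ G′ t₀ * G′ t₀} types λ {t₀} _ →
        *-cong (sumOver-cong {f = λ t₁ → level₁ G t₀ t₁ * G t₁} {g = λ t₁ → level₁ G′ t₀ t₁ * G′ t₁} types λ {t₁} _ →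
          *-cong (sumOver-cong {f = λ t₂ → bridgeSum π t₀ t₁ t₂ * G t₂} {g = λ t₂ → bridgeSum π t₀ t₁ t₂ * G′ t₂} types λ {t₂} _ →
            *-cong refl (G≈G′ t₂)) (G≈G′ t₁)) (G≈G′ t₀)
      where
      level₁ : (Maybe Partition → Carrier) → Maybe Partition → Maybe Partition → Carrier
      level₁ G t₀ t₁ = sumOver (λ t₂ → bridgeSum π t₀ t₁ t₂ * G t₂) types
      level₀ : (Maybe Partition → Carrier) → Maybe Partition → Carrier
      level₀ G t₀ = sumOver (λ t₁ → level₁ G t₀ t₁ * G t₁) types

    va vb vc vT vU vR vL vQ : Polynomial 9
    va = var zero
    vb = var (suc zero)
    vc = var (suc (suc zero))
    vT = var (suc (suc (suc zero)))
    vU = var (suc (suc (suc (suc zero))))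
    vR = var (suc (suc (suc (suc (suc zero)))))
    vL = var (suc (suc (suc (suc (suc (suc zero))))))
    vQ = var (suc (suc (suc (suc (suc (suc (suc zero)))))))

    -- The ninth variable is the total weight of spanning subgraphs of no type; it drops out of the recurrences.
    typeVar : Maybe Partition → Polynomial 9
    typeVar nothing = var (suc (suc (suc (suc (suc (suc (suc (suc zero))))))))
    typeVar (just πT) = vT
    typeVar (just πU) = vU
    typeVar (just πR) = vR
    typeVar (just πL) = vL
    typeVar (just πQ) = vQ

    genVar : Gen → Polynomial 9
    genVar ga = va
    genVar gb = vb
    genVar gc = vc

    composePoly : Partition → Polynomial 9
    composePoly π = BridgeSums.composeSum _:+_ _:*_ (con 0) (con 1) genVar π typeVar

    module _ (m : ℕ) where
      private
        n = suc m

      ρ : Vec Carrier 9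
      ρ = a ∷ b ∷ c ∷ T n ∷ U n ∷ R n ∷ L n ∷ Q n ∷ typeSum n nothing ∷ []

      typeSum≈⟦typeVar⟧ : ∀ t → typeSum n t ≈ ⟦ typeVar t ⟧ ρ
      typeSum≈⟦typeVar⟧ nothing = refl
      typeSum≈⟦typeVar⟧ (just πT) = typeSum-just n πT
      typeSum≈⟦typeVar⟧ (just πU) = typeSum-just n πU
      typeSum≈⟦typeVar⟧ (just πR) = typeSum-just n πR
      typeSum≈⟦typeVar⟧ (just πL) = typeSum-just n πL
      typeSum≈⟦typeVar⟧ (just πQ) = typeSum-just n πQ

      recurrence : ∀ π → gsum (suc n) (forestPredicate π) ≈ composeSum π (λ t → ⟦ typeVar t ⟧ ρ)
      recurrence π = trans (gsum-suc m π) (composeSum-cong π typeSum≈⟦typeVar⟧)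

    weightPoly : ∀ {k} → List (Edge k) → Polynomial 9
    weightPoly = foldr (λ e acc → genVar (proj₁ e) :* acc) (con 1)

    levelOnePoly : Partition → Polynomial 9
    levelOnePoly π = RawSums.sumOver _:+_ (con 0) (λ F → RawSums.when _:+_ (con 0) (forestPredicate π F) (weightPoly F)) (sublists (edges 1))

    S-poly T-rhs U-rhs R-rhs L-rhs Q-rhs : Polynomial 9
    S-poly = va :* vb :+ va :* vc :+ vb :* vc
    T-rhs = vT :* vT :* vT :* S-poly :+ con 2 :* va :* vb :* vc :* (vT :* vT) :* (vU :+ vR :+ vL)
    U-rhs = vb :* (vT :* vT :* vT) :+ vT :* vT :* (S-poly :* vU :+ con 2 :* vb :* (va :* vR :+ vc :* vL))
      :+ va :* vb :* vc :* vT :* (con 3 :* vR :* vL :+ vU :* (vL :+ vR :+ con 2 :* vU)) :+ va :* vb :* vc :* (vT :* vT) :* vQ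
    R-rhs = va :* (vT :* vT :* vT) :+ vT :* vT :* (S-poly :* vR :+ con 2 :* va :* (vb :* vU :+ vc :* vL))
      :+ va :* vb :* vc :* vT :* (con 3 :* vU :* vL :+ vR :* (vL :+ vU :+ con 2 :* vR)) :+ va :* vb :* vc :* (vT :* vT) :* vQ
    L-rhs = vc :* (vT :* vT :* vT) :+ vT :* vT :* (S-poly :* vL :+ con 2 :* vc :* (va :* vR :+ vb :* vU))
      :+ va :* vb :* vc :* vT :* (con 3 :* vR :* vU :+ vL :* (vU :+ vR :+ con 2 :* vL)) :+ va :* vb :* vc :* (vT :* vT) :* vQ
    Q-rhs = (con 2 :+ con 2) :* va :* vb :* vc :* vT :* vQ :* (vU :+ vR :+ vL)
      :+ vT :* vT :* ((con 2 :* vb :+ va :+ vc) :* vU :+ (con 2 :* va :+ vb :+ vc) :* vR :+ (con 2 :* vc :+ va :+ vb) :* vL)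
      :+ vT :* vT :* vQ :* S-poly :+ vT :* vT :* vT
      :+ con 2 :* va :* vb :* vc :* (vU :* vU :* (vR :+ vL) :+ vR :* vR :* (vU :+ vL) :+ vL :* vL :* (vU :+ vR) :+ vU :* vR :* vL)
      :+ con 2 :* vT :* (vU :* vR :* (va :* vc :+ vb :* vc :+ con 2 :* va :* vb) :+ vU :* vL :* (va :* vb :+ va :* vc :+ con 2 :* vb :* vc)
                        :+ vR :* vL :* (va :* vb :+ vb :* vc :+ con 2 :* va :* vc) :+ vb :* (vU :* vU) :* (va :+ vc)
                        :+ va :* (vR :* vR) :* (vb :+ vc) :+ vc :* (vL :* vL) :* (va :+ vb))

open ForestTypes using (πT; πU; πR; πL; πQ)
open Recurrence

theorem3p2 : ∀ {r ℓ} (Rg : CommutativeSemiring r ℓ) (a b c : CommutativeSemiring.Carrier Rg) →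
    let open CommutativeSemiring Rg
        open GF Rg a b c
        S = a * b + a * c + b * c
    in (T 1 ≈ S) × (U 1 ≈ b) × (R 1 ≈ a) × (L 1 ≈ c) × (Q 1 ≈ 1#)
       × ((n : ℕ) → 1 ≤ n →
           (T (suc n) ≈ T n * T n * T n * S + two * a * b * c * (T n * T n) * (U n + R n + L n))
         × (U (suc n) ≈ b * (T n * T n * T n)
             + T n * T n * (S * U n + two * b * (a * R n + c * L n))
             + a * b * c * T n * (three * R n * L n + U n * (L n + R n + two * U n))
             + a * b * c * (T n * T n) * Q n)
         × (R (suc n) ≈ a * (T n * T n * T n)
             + T n * T n * (S * R n + two * a * (b * U n + c * L n))
             + a * b * c * T n * (three * U n * L n + R n * (L n + U n + two * R n))
             + a * b * c * (T n * T n) * Q n)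
         × (L (suc n) ≈ c * (T n * T n * T n)
             + T n * T n * (S * L n + two * c * (a * R n + b * U n))
             + a * b * c * T n * (three * R n * U n + L n * (U n + R n + two * L n))
             + a * b * c * (T n * T n) * Q n)
         × (Q (suc n) ≈ four * a * b * c * T n * Q n * (U n + R n + L n)
             + T n * T n * ((two * b + a + c) * U n + (two * a + b + c) * R n + (two * c + a + b) * L n)
             + T n * T n * Q n * S
             + T n * T n * T n
             + two * a * b * c * (U n * U n * (R n + L n) + R n * R n * (U n + L n)
                                  + L n * L n * (U n + R n) + U n * R n * L n)
             + two * T n * (U n * R n * (a * c + b * c + two * a * b)
                            + U n * L n * (a * b + a * c + two * b * c)
                            + R n * L n * (a * b + b * c + two * a * c)
                            + b * (U n * U n) * (a + c)
                            + a * (R n * R n) * (b + c)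
                            + c * (L n * L n) * (a + b))))
theorem3p2 Rg a b c =
  prove (ρ 0) (levelOnePoly πT) S-poly refl , prove (ρ 0) (levelOnePoly πU) vb refl ,
  prove (ρ 0) (levelOnePoly πR) va refl , prove (ρ 0) (levelOnePoly πL) vc refl ,
  prove (ρ 0) (levelOnePoly πQ) (con 1) refl ,
  λ { zero () ; (suc m) _ →
      trans (recurrence m πT) (prove (ρ m) (composePoly πT) T-rhs refl) ,
      trans (recurrence m πU) (prove (ρ m) (composePoly πU) U-rhs refl) ,
      trans (recurrence m πR) (prove (ρ m) (composePoly πR) R-rhs refl) ,
      trans (recurrence m πL) (prove (ρ m) (composePoly πL) L-rhs refl) ,
      trans (recurrence m πQ) (prove (ρ m) (composePoly πQ) Q-rhs refl) }
  where
  open CommutativeSemiring Rg using (refl; trans)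
  open Recurrences Rg a b c
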